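{- Let $c$ be a Coxeter element of $A_n$ and $N=\binom{n+1}{2}$. There exists a unique $N\times N$ lower unitriangular matrix $\mathcal{U}_c$ such that $\mathcal{U}_c\,\Pi_c(X(b_i))=o(b_i)$ for all $1\le i\le N$, where $o(b_i)\in\mathbb{R}^N$ is the vector whose last $i$ entries equal $1$ and whose other entries equal $0$.
   Context: $A_n$ is the symmetric group on $[n+1]$, $s_i$ exchanges $i,i+1$, permutations compose as functions; $X(w)$ is the $(n+1)\times(n+1)$ matrix with $1$ in position $(i,w(i))$ and $0$ elsewhere. A Coxeter element is $c=s_{a_1}\cdots s_{a_n}$ with $(a_1,\dots,a_n)$ a permutation of $[n]$. For $i\in\{2,\dots,n\}$, $i$ is lower-barred if $i-1$ precedes $i$ in $(a_1,\dots,a_n)$, upper-barred otherwise; $d_1<\dots<d_r$ are the lower-barred and $u_1<\dots<u_s$ the upper-barred numbers. As a permutation, $c$ is the cycle $1\mapsto d_1\mapsto\cdots\mapsto d_r\mapsto n+1\mapsto u_s\mapsto\cdots\mapsto u_1\mapsto 1$. Projection $\Pi_c:\mathbb{R}^{(n+1)\times(n+1)}\to\mathbb{R}^N$: list, for $k=1,\dots,r$, positions $(d_k-1,d_k),\dots,(1,d_k)$; then $(n,n+1),\dots,(1,n+1)$; then for each upper-barred $u$ in decreasing order, with $m=\min(u-1,n+1-u)$, positions $(n+1,c(u)),(n,c^2(u)),\dots,(n+2-m,c^m(u))$, followed if $u>\frac{n+2}{2}$ by $(u-1,u),\dots,(m+1,u)$. Reverse this list; $\Pi_c(X)$ has $k$-th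 coordinate equal to the entry of $X$ at the $k$-th position of the reversed list. $R_c=[R(1)\cdots R(N)]$ is the word $[(d_1-1)\cdots1]\cdots[(d_r-1)\cdots1][n\cdots1][n\cdots(n-u_s+2)]\cdots[n\cdots(n-u_1+2)]$ (each bracket a decreasing run of consecutive integers), and $b_i=s_{R(1)}\cdots s_{R(i)}$.
   Formalization: Uniqueness of $\mathcal{U}_c$ is asserted only among lower unitriangular matrices with rational entries, and $\mathcal{U}_c$ itself has entries in ℚ rather than ℝ. -}

module Defs where

open import Data.Bool using (Bool; true; false; if_then_else_; _∧_)
open import Data.Nat using (ℕ; zero; suc; _+_; _*_; _∸_; _<ᵇ_; _≡ᵇ_; pred; _⊔_; _⊓_)
open import Data.Nat.Combinatorics using (_C_)
open import Data.Fin using (Fin; toℕ)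
import Data.Fin as F
open import Data.List using (List; []; _∷_; _++_; map; upTo; reverse; filterᵇ; concatMap; foldr; take)
open import Data.Maybe using (Maybe; just; nothing)
open import Data.Product using (_×_; _,_)
open import Data.Rational using (ℚ; 0ℚ; 1ℚ) renaming (_+_ to _+ℚ_; _*_ to _*ℚ_)
open import Relation.Binary.PropositionalEquality using (_≡_)

-- All permutations are functions ℕ → ℕ (acting on [n+1] = {1,…,n+1},
-- identity elsewhere); composition is composition of functions.

s : ℕ → ℕ → ℕ
s i x = if x ≡ᵇ i then suc i else (if x ≡ᵇ suc i then i else x)

wordPerm : List ℕ → ℕ → ℕ
wordPerm w x = foldr (λ i y → s i y) x w

cox : List ℕ → ℕ → ℕ
cox a = wordPerm a

-- position of a value in a list (length of list if absent)
indexOf : ℕ → List ℕ → ℕ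
indexOf v [] = 0
indexOf v (x ∷ xs) = if x ≡ᵇ v then 0 else suc (indexOf v xs)

lowerBarred : List ℕ → ℕ → Bool
lowerBarred a i = indexOf (pred i) a <ᵇ indexOf i a

upperBarred : List ℕ → ℕ → Bool
upperBarred a i = if lowerBarred a i then false else true

twoToN : ℕ → List ℕ
twoToN n = map (λ k → 2 + k) (upTo (n ∸ 1))

dList : ℕ → List ℕ → List ℕ
dList n a = filterᵇ (lowerBarred a) (twoToN n)

uList : ℕ → List ℕ → List ℕ
uList n a = filterᵇ (upperBarred a) (twoToN n)

decRun : ℕ → ℕ → List ℕ
decRun hi zero = []
decRun hi (suc l) = hi ∷ decRun (pred hi) l

iter : (ℕ → ℕ) → ℕ → ℕ → ℕ
iter f zero x = x
iter f (suc k) x = f (iter f k x)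

uPositions : ℕ → List ℕ → ℕ → List (ℕ × ℕ)
uPositions n a u =
  map (λ t → (n + 1 ∸ t , iter (cox a) (suc t) u)) (upTo m)
  ++ (if (n + 2) <ᵇ (2 * u) then map (λ i → (i , u)) (decRun (u ∸ 1) (u ∸ 1 ∸ m)) else [])
  where
  m : ℕ
  m = (u ∸ 1) ⊓ (n + 1 ∸ u)

positionsRaw : ℕ → List ℕ → List (ℕ × ℕ)
positionsRaw n a =
  concatMap (λ d → map (λ i → (i , d)) (decRun (d ∸ 1) (d ∸ 1))) (dList n a)
  ++ map (λ i → (i , n + 1)) (decRun n n)
  ++ concatMap (uPositions n a) (reverse (uList n a))

positions : ℕ → List ℕ → List (ℕ × ℕ)
positions n a = reverse (positionsRaw n a)

nth : {A : Set} → List A → ℕ → Maybe A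
nth [] k = nothing
nth (x ∷ xs) zero = just x
nth (x ∷ xs) (suc k) = nth xs k

Nn : ℕ → ℕ
Nn n = suc n C 2

-- permutation matrix X(w): entry (i,j) (1-indexed) is 1 iff w(i) = j
Xmat : (ℕ → ℕ) → ℕ → ℕ → ℚ
Xmat w i j = if w i ≡ᵇ j then 1ℚ else 0ℚ

Proj : (n : ℕ) → List ℕ → (ℕ → ℕ → ℚ) → Fin (Nn n) → ℚ
Proj n a X k with nth (positions n a) (toℕ k)
... | just (i , j) = X i j
... | nothing = 0ℚ

Rword : ℕ → List ℕ → List ℕ
Rword n a =
  concatMap (λ d → decRun (d ∸ 1) (d ∸ 1)) (dList n a)
  ++ decRun n n
  ++ concatMap (λ u → decRun n (u ∸ 1)) (reverse (uList n a))

bElt : ℕ → List ℕ → ℕ → (ℕ → ℕ)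
bElt n a i = wordPerm (take i (Rword n a))

-- o(b_i): last i entries 1, others 0 (k is 0-indexed)
oVec : (N i : ℕ) → Fin N → ℚ
oVec N i k = if (N ∸ i) <ᵇ suc (toℕ k) then 1ℚ else 0ℚ

sumF : {m : ℕ} → (Fin m → ℚ) → ℚ
sumF {zero} f = 0ℚ
sumF {suc m} f = f F.zero +ℚ sumF (λ k → f (F.suc k))

Matrix : ℕ → Set
Matrix m = Fin m → Fin m → ℚ

mulVec : {m : ℕ} → Matrix m → (Fin m → ℚ) → Fin m → ℚ
mulVec U v k = sumF (λ j → U k j *ℚ v j)

LowerUnitri : {m : ℕ} → Matrix m → Set
LowerUnitri {m} U = (∀ i → U i i ≡ 1ℚ) × (∀ i j → toℕ i Data.Nat.< toℕ j → U i j ≡ 0ℚ)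

-- U Π_c(X(b_i)) = o(b_i) for all 1 ≤ i ≤ N  (i = suc (toℕ t))
Solves : (n : ℕ) → List ℕ → Matrix (Nn n) → Set
Solves n a U = ∀ (t : Fin (Nn n)) (k : Fin (Nn n)) →
  mulVec U (Proj n a (Xmat (bElt n a (suc (toℕ t))))) k ≡ oVec (Nn n) (suc (toℕ t)) k

{-# OPTIONS --safe #-}
-- Write p_1, …, p_N for the positions defining Π_c before the reversal. The heart of the proof is that
-- p_k = (row, col) is first reached at step k: b_k(row) = col, but b_i(row) ≠ col for i < k. Listing
-- the vectors Π_c(X(b_i)) in the order i = N, …, 1 therefore gives a lower unitriangular matrix Q, so
-- U Π_c(X(b_i)) = o(b_i) splits into one triangular system per row of U; as o(b_N), …, o(b_1) vanish
-- above the same diagonal, the unique solution U_c is lower unitriangular.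
--
-- To see where b_i⁻¹(col) goes as i grows, apply the letters of R_c one at a time. Along a decreasing
-- run [h ⋯ h−l+1] a value moves by at most one: h+1 falls to h−l+1, each of h−l+1, …, h rises by one,
-- and all other values stay. So the run [(d−1) ⋯ 1] of a lower-barred d hits (d−1, d), …, (1, d) in turn,
-- and [n ⋯ 1] does the same for the column n+1. After the head [(d₁−1)⋯1] ⋯ [(d_r−1)⋯1] [n⋯1] of R_c,
-- x ∈ [1, n] has reached its level ℓ(x). Since c is the cycle 1 → d₁ → ⋯ → d_r → n+1 → u_s → ⋯ → u₁ → 1,
-- ℓ(c x) = ℓ(x) − 1, and this locates c^{t+1}(u) when the run [n ⋯ n−u+2] of an upper-barred u begins,
-- which is exactly what the positions (n+1−t, c^{t+1}(u)) of Π_c require.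
module Submission where

open import Defs
open import Data.Bool using (Bool; true; false; if_then_else_; T)
open import Data.Empty using (⊥-elim)
open import Data.Fin using (Fin; toℕ; opposite)
import Data.Fin as Fin
open import Data.Fin.Properties using (opposite-prop; opposite-involutive; toℕ<n)
open import Data.List using (List; []; _∷_; _++_; [_]; map; upTo; applyUpTo; reverse; filterᵇ; concatMap; take; length)
open import Data.List.Membership.Propositional using (_∈_; _∉_)
open import Data.List.Membership.Propositional.Properties using (∈-map⁺; ∈-map⁻; ∈-upTo⁺; ∈-upTo⁻)
open import Data.List.Properties
  using (++-assoc; ++-identityʳ; length-++; length-map; unfold-reverse; length-reverse; filter-++; length-filter;
         concatMap-++; foldr-++; take-all; length-upTo; map-upTo; map-++; take-take)
open import Data.List.Relation.Binary.Permutation.Propositional using (_↭_; ↭⇒↭ₛ; ↭-sym)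
import Data.List.Relation.Binary.Permutation.Propositional.Properties as ↭
import Data.List.Relation.Unary.All as All
open import Data.List.Relation.Unary.AllPairs using (_∷_)
open import Data.List.Relation.Unary.Any using (here; there)
open import Data.List.Relation.Unary.Unique.Propositional using (Unique)
import Data.List.Relation.Unary.Unique.Propositional.Properties as Unique
open import Data.Maybe using (just; nothing)
open import Data.Maybe.Properties using (just-injective)
open import Data.Nat
open import Data.Nat.Combinatorics using (_C_; nC1≡n; nCk+nC[k+1]≡[n+1]C[k+1])
open import Data.Nat.ListAction using (sum)
open import Data.Nat.ListAction.Properties using (sum-++; sum-↭)
open import Data.Nat.Properties
open import Data.Nat.Tactic.RingSolver using (solve-∀)
open import Data.Product using (_×_; _,_; proj₁; proj₂; Σ; ∃; ∃₂)
open import Data.Rational using (ℚ; 0ℚ; 1ℚ; -_) renaming (_+_ to _+ℚ_; _*_ to _*ℚ_; _-_ to _-ℚ_)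
import Data.Rational.Properties as ℚ
open import Data.Sum using (_⊎_; inj₁; inj₂)
open import Data.Unit using (⊤; tt)
open import Function using (_⇔_; mk⇔; Equivalence)
open import Relation.Binary.PropositionalEquality hiding ([_])
open import Relation.Nullary using (yes; no)
open import Relation.Nullary.Decidable using (T?)
open import Data.List.Relation.Binary.Permutation.Setoid.Properties (setoid ℕ) using (Unique-resp-↭)

≡ᵇ-refl : ∀ m → (m ≡ᵇ m) ≡ true
≡ᵇ-refl zero = refl
≡ᵇ-refl (suc m) = ≡ᵇ-refl m

≢⇒≡ᵇ≡false : ∀ m n → m ≢ n → (m ≡ᵇ n) ≡ false
≢⇒≡ᵇ≡false zero zero m≢n = ⊥-elim (m≢n refl)
≢⇒≡ᵇ≡false zero (suc n) _ = refl
≢⇒≡ᵇ≡false (suc m) zero _ = refl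
≢⇒≡ᵇ≡false (suc m) (suc n) m≢n = ≢⇒≡ᵇ≡false m n (λ m≡n → m≢n (cong suc m≡n))

≡ᵇ≡true⇒≡ : ∀ m n → (m ≡ᵇ n) ≡ true → m ≡ n
≡ᵇ≡true⇒≡ m n eq = ≡ᵇ⇒≡ m n (subst T (sym eq) tt)

<ᵇ≡true⇒< : ∀ m n → (m <ᵇ n) ≡ true → m < n
<ᵇ≡true⇒< m n eq = <ᵇ⇒< m n (subst T (sym eq) tt)

n<ᵇ1+n : ∀ x → (x <ᵇ suc x) ≡ true
n<ᵇ1+n zero = refl
n<ᵇ1+n (suc x) = n<ᵇ1+n x

<ᵇ≡false⇒≥ : ∀ m n → (m <ᵇ n) ≡ false → n ≤ m
<ᵇ≡false⇒≥ m n eq = ≮⇒≥ (λ m<n → subst T eq (<⇒<ᵇ m<n))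

s-at : ∀ l → s l l ≡ suc l
s-at l rewrite ≡ᵇ-refl l = refl

s-at-suc : ∀ l → s l (suc l) ≡ l
s-at-suc l rewrite ≢⇒≡ᵇ≡false (suc l) l (1+n≢n {l}) | ≡ᵇ-refl l = refl

s-fix : ∀ l x → x ≢ l → x ≢ suc l → s l x ≡ x
s-fix l x x≢l x≢1+l rewrite ≢⇒≡ᵇ≡false x l x≢l | ≢⇒≡ᵇ≡false x (suc l) x≢1+l = refl

s-involutive : ∀ l x → s l (s l x) ≡ x
s-involutive l x with x ≟ l
... | yes refl rewrite s-at l = s-at-suc l
... | no x≢l with x ≟ suc l
...   | yes refl rewrite s-at-suc l = s-at l
...   | no x≢1+l rewrite s-fix l x x≢l x≢1+l = s-fix l x x≢l x≢1+l

wordPerm-∷ʳ : ∀ w l v → wordPerm (w ++ [ l ]) v ≡ wordPerm w (s l v)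
wordPerm-∷ʳ w l v = foldr-++ s v w [ l ]

wordPerm⁻¹ : List ℕ → ℕ → ℕ
wordPerm⁻¹ [] x = x
wordPerm⁻¹ (l ∷ w) x = wordPerm⁻¹ w (s l x)

wordPerm⁻¹-++ : ∀ u w x → wordPerm⁻¹ (u ++ w) x ≡ wordPerm⁻¹ w (wordPerm⁻¹ u x)
wordPerm⁻¹-++ [] w x = refl
wordPerm⁻¹-++ (l ∷ u) w x = wordPerm⁻¹-++ u w (s l x)

ends-++ : ∀ u w {x y z} → wordPerm⁻¹ u x ≡ y → wordPerm⁻¹ w y ≡ z → wordPerm⁻¹ (u ++ w) x ≡ z
ends-++ u w {x} refl refl = wordPerm⁻¹-++ u w x

wordPerm-inverse : ∀ w x y → wordPerm w y ≡ x ⇔ wordPerm⁻¹ w x ≡ y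
wordPerm-inverse w x y = mk⇔ (to w x y) (from w x y)
  where
  to : ∀ w x y → wordPerm w y ≡ x → wordPerm⁻¹ w x ≡ y
  to [] x y eq = sym eq
  to (l ∷ w) x y eq = to w (s l x) y (trans (sym (s-involutive l (wordPerm w y))) (cong (s l) eq))
  from : ∀ w x y → wordPerm⁻¹ w x ≡ y → wordPerm w y ≡ x
  from [] x y eq = sym eq
  from (l ∷ w) x y eq = trans (cong (s l) (from w (s l x) y eq)) (s-involutive l x)

Avoids : List ℕ → ℕ → ℕ → Set
Avoids [] x r = x ≢ r
Avoids (l ∷ w) x r = x ≢ r × Avoids w (s l x) r

avoids-++ : ∀ u w x r → Avoids u x r → Avoids w (wordPerm⁻¹ u x) r → Avoids (u ++ w) x r
avoids-++ [] w x r _ avw = avw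
avoids-++ (l ∷ u) w x r (x≢r , avu) avw = x≢r , avoids-++ u w (s l x) r avu avw

avoids-take : ∀ w x r i → Avoids w x r → wordPerm⁻¹ (take i w) x ≢ r
avoids-take [] x r zero av = av
avoids-take [] x r (suc i) av = av
avoids-take (l ∷ w) x r zero (x≢r , _) = x≢r
avoids-take (l ∷ w) x r (suc i) (_ , av) = avoids-take w (s l x) r i av

Ascends : List ℕ → ℕ → Set
Ascends [] x = ⊤
Ascends (l ∷ w) x = x ≤ s l x × Ascends w (s l x)

Descends : List ℕ → ℕ → Set
Descends [] x = ⊤
Descends (l ∷ w) x = s l x ≤ x × Descends w (s l x)

Rises : List ℕ → ℕ → ℕ → Set
Rises w x y = wordPerm⁻¹ w x ≡ y × Ascends w x

Falls : List ℕ → ℕ → ℕ → Set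
Falls w x y = wordPerm⁻¹ w x ≡ y × Descends w x

rises-[] : ∀ x → Rises [] x x
rises-[] x = refl , tt

rises-++ : ∀ u w {x y z} → Rises u x y → Rises w y z → Rises (u ++ w) x z
rises-++ [] w (refl , _) rw = rw
rises-++ (l ∷ u) w (end , step , asu) rw =
  let end′ , as′ = rises-++ u w (end , asu) rw in end′ , step , as′

rises-≤ : ∀ w {x y} → Rises w x y → x ≤ y
rises-≤ [] (refl , _) = ≤-refl
rises-≤ (l ∷ w) (end , step , as) = ≤-trans step (rises-≤ w (end , as))

falls-≤ : ∀ w {x y} → Falls w x y → y ≤ x
falls-≤ [] (refl , _) = ≤-refl
falls-≤ (l ∷ w) (end , step , ds) = ≤-trans (falls-≤ w (end , ds)) step

rises⇒avoids-below : ∀ w {x y r} → Rises w x y → r < x → Avoids w x r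
rises⇒avoids-below [] _ r<x = >⇒≢ r<x
rises⇒avoids-below (l ∷ w) (end , step , as) r<x =
  >⇒≢ r<x , rises⇒avoids-below w (end , as) (<-≤-trans r<x step)

rises⇒avoids-above : ∀ w {x y r} → Rises w x y → y < r → Avoids w x r
rises⇒avoids-above [] (refl , _) y<r = <⇒≢ y<r
rises⇒avoids-above (l ∷ w) (end , step , as) y<r =
  <⇒≢ (≤-<-trans (≤-trans step (rises-≤ w (end , as))) y<r) , rises⇒avoids-above w (end , as) y<r

falls⇒avoids-below : ∀ w {x y r} → Falls w x y → r < y → Avoids w x r
falls⇒avoids-below [] (refl , _) r<y = >⇒≢ r<y
falls⇒avoids-below (l ∷ w) (end , step , ds) r<y =
  >⇒≢ (<-≤-trans r<y (≤-trans (falls-≤ w (end , ds)) step)) , falls⇒avoids-below w (end , ds) r<y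

falls⇒avoids-above : ∀ w {x y r} → Falls w x y → x < r → Avoids w x r
falls⇒avoids-above [] _ x<r = <⇒≢ x<r
falls⇒avoids-above (l ∷ w) (end , step , ds) x<r =
  <⇒≢ x<r , falls⇒avoids-above w (end , ds) (≤-<-trans step x<r)

Dips : List ℕ → ℕ → Set
Dips w x = ∀ r → x < r → wordPerm⁻¹ w x < r → Avoids w x r

falls-++-rises⇒dips : ∀ u w {x y z} → Falls u x y → Rises w y z → Dips (u ++ w) x
falls-++-rises⇒dips u w {x} fu@(refl , _) rw@(refl , _) r x<r end<r =
  avoids-++ u w x r (falls⇒avoids-above u fu x<r)
    (rises⇒avoids-above w rw (subst (_< r) (wordPerm⁻¹-++ u w x) end<r))

fixes-++-dips : ∀ u w {x} → Rises u x x → Dips w x → Dips (u ++ w) x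
fixes-++-dips u w {x} ru@(fixed , _) dw r x<r end<r =
  avoids-++ u w x r (rises⇒avoids-above u ru x<r)
    (subst (λ y → Avoids w y r) (sym fixed)
      (dw r x<r (subst (_< r) (trans (wordPerm⁻¹-++ u w x) (cong (wordPerm⁻¹ w) fixed)) end<r)))

dips-++-rises : ∀ u w {x z} → Dips u x → Rises w (wordPerm⁻¹ u x) z → Dips (u ++ w) x
dips-++-rises u w {x} du rw@(refl , _) r x<r end<r =
  avoids-++ u w x r (du r x<r (≤-<-trans (rises-≤ w rw) end′<r)) (rises⇒avoids-above w rw end′<r)
  where
  end′<r : wordPerm⁻¹ w (wordPerm⁻¹ u x) < r
  end′<r = subst (_< r) (wordPerm⁻¹-++ u w x) end<r

-- Decreasing runs

length-decRun : ∀ hi len → length (decRun hi len) ≡ len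
length-decRun hi zero = refl
length-decRun hi (suc len) = cong suc (length-decRun (pred hi) len)

pred[m]∸n≡m∸1+n : ∀ m n → pred m ∸ n ≡ m ∸ suc n
pred[m]∸n≡m∸1+n zero zero = refl
pred[m]∸n≡m∸1+n zero (suc n) = refl
pred[m]∸n≡m∸1+n (suc m) n = refl

decRun-++ : ∀ hi len₁ len₂ → decRun hi (len₁ + len₂) ≡ decRun hi len₁ ++ decRun (hi ∸ len₁) len₂
decRun-++ hi zero len₂ = refl
decRun-++ hi (suc len₁) len₂
  rewrite decRun-++ (pred hi) len₁ len₂ | pred[m]∸n≡m∸1+n hi len₁ = refl

take-decRun : ∀ hi len e → e ≤ len → take e (decRun hi len) ≡ decRun hi e
take-decRun hi len zero _ = refl
take-decRun hi (suc len) (suc e) (s≤s e≤len) = cong (hi ∷_) (take-decRun (pred hi) len e e≤len)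

nth-decRun⁻ : ∀ hi len e x → nth (decRun hi len) e ≡ just x → e < len × x ≡ hi ∸ e
nth-decRun⁻ hi (suc len) zero x refl = s≤s z≤n , refl
nth-decRun⁻ hi (suc len) (suc e) x eq with nth-decRun⁻ (pred hi) len e x eq
... | e<len , refl = s≤s e<len , pred[m]∸n≡m∸1+n hi e

decRun-top : ∀ hi len → len ≤ hi → Falls (decRun hi len) (suc hi) (suc hi ∸ len)
decRun-top hi zero _ = refl , tt
decRun-top (suc h) (suc l) (s≤s l≤h) rewrite s-at-suc (suc h) =
  let end , ds = decRun-top h l l≤h in end , n≤1+n (suc h) , ds

decRun-outside-step : ∀ h l v → v + suc l ≤ suc h ⊎ suc (suc h) < v →
  v ≢ suc h × v ≢ suc (suc h) × (v + l ≤ h ⊎ suc h < v)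
decRun-outside-step h l v (inj₁ below) = ≢h , ≢h+1 , inj₁ (≤-pred (subst (_≤ suc h) (+-suc v l) below))
  where
  ≢h : v ≢ suc h
  ≢h refl = m+1+n≰m (suc h) below
  ≢h+1 : v ≢ suc (suc h)
  ≢h+1 refl = m+1+n≰m (suc h) (≤-trans (+-monoˡ-≤ (suc l) (n≤1+n (suc h))) below)
decRun-outside-step h l v (inj₂ above) = (λ { refl → 1+n≰n (<⇒≤ above) }) , >⇒≢ above , inj₂ (<-trans (n<1+n (suc h)) above)

decRun-outside : ∀ hi len v → len ≤ hi → v + len ≤ hi ⊎ suc hi < v → Rises (decRun hi len) v v
decRun-outside hi zero v _ _ = refl , tt
decRun-outside (suc h) (suc l) v (s≤s l≤h) outside with decRun-outside-step h l v outside
... | v≢h , v≢h+1 , outside′ rewrite s-fix (suc h) v v≢h v≢h+1 =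
  let end , as = decRun-outside h l v l≤h outside′ in end , ≤-refl , as

decRun-inside : ∀ hi len v → len ≤ hi → v ≤ hi → suc hi ≤ v + len → Rises (decRun hi len) v (suc v)
decRun-inside hi zero v _ v≤hi hi<v = ⊥-elim (<⇒≱ (subst (hi <_) (+-identityʳ v) hi<v) v≤hi)
decRun-inside (suc h) (suc l) v (s≤s l≤h) v≤hi hi<v+len with v ≟ suc h
... | yes refl rewrite s-at (suc h) =
  let end , as = decRun-outside h l (suc (suc h)) l≤h (inj₂ (n<1+n (suc h))) in end , n≤1+n (suc h) , as
... | no v≢hi rewrite s-fix (suc h) v v≢hi (λ v≡ → 1+n≰n (subst (_≤ suc h) v≡ v≤hi)) =
  let end , as = decRun-inside h l v l≤h (≤-pred (≤∧≢⇒< v≤hi v≢hi))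
                   (≤-pred (subst (suc (suc h) ≤_) (+-suc v l) hi<v+len))
  in end , ≤-refl , as

module _ {A : Set} where

  nth⇒< : ∀ (xs : List A) e {x} → nth xs e ≡ just x → e < length xs
  nth⇒< (_ ∷ xs) zero _ = s≤s z≤n
  nth⇒< (_ ∷ xs) (suc e) eq = s≤s (nth⇒< xs e eq)

  <⇒nth : ∀ (xs : List A) e → e < length xs → ∃ λ x → nth xs e ≡ just x
  <⇒nth (x ∷ xs) zero _ = x , refl
  <⇒nth (x ∷ xs) (suc e) (s≤s e<len) = <⇒nth xs e e<len

  nth-++ˡ : ∀ (xs ys : List A) e → e < length xs → nth (xs ++ ys) e ≡ nth xs e
  nth-++ˡ (x ∷ xs) ys zero _ = refl
  nth-++ˡ (x ∷ xs) ys (suc e) (s≤s e<len) = nth-++ˡ xs ys e e<len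

  nth-++ʳ : ∀ (xs ys : List A) e → nth (xs ++ ys) (length xs + e) ≡ nth ys e
  nth-++ʳ [] ys e = refl
  nth-++ʳ (x ∷ xs) ys e = nth-++ʳ xs ys e

  take-++ˡ : ∀ (xs ys : List A) e → e ≤ length xs → take e (xs ++ ys) ≡ take e xs
  take-++ˡ xs ys zero _ = refl
  take-++ˡ (x ∷ xs) ys (suc e) (s≤s e≤len) = cong (x ∷_) (take-++ˡ xs ys e e≤len)

  take-++ʳ : ∀ (xs ys : List A) e → take (length xs + e) (xs ++ ys) ≡ xs ++ take e ys
  take-++ʳ [] ys e = refl
  take-++ʳ (x ∷ xs) ys e = cong (x ∷_) (take-++ʳ xs ys e)

  nth-reverse : ∀ (xs : List A) e → e < length xs → nth (reverse xs) e ≡ nth xs (length xs ∸ suc e)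
  nth-reverse (x ∷ xs) e e<len rewrite unfold-reverse x xs with e <? length xs
  ... | yes e<len′ = begin
    nth (reverse xs ++ [ x ]) e        ≡⟨ nth-++ˡ (reverse xs) [ x ] e (subst (e <_) (sym (length-reverse xs)) e<len′) ⟩
    nth (reverse xs) e                 ≡⟨ nth-reverse xs e e<len′ ⟩
    nth (x ∷ xs) (suc (length xs ∸ suc e)) ≡⟨ cong (nth (x ∷ xs)) (sym (+-∸-assoc 1 e<len′)) ⟩
    nth (x ∷ xs) (suc (length xs) ∸ suc e) ∎
    where open ≡-Reasoning
  ... | no e≮len with ≤-antisym (≤-pred e<len) (≮⇒≥ e≮len)
  ... | refl = begin
    nth (reverse xs ++ [ x ]) (length xs)        ≡⟨ cong (nth (reverse xs ++ [ x ])) (sym (trans (+-identityʳ _) (length-reverse xs))) ⟩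
    nth (reverse xs ++ [ x ]) (length (reverse xs) + 0) ≡⟨ nth-++ʳ (reverse xs) [ x ] 0 ⟩
    just x                                       ≡⟨ cong (nth (x ∷ xs)) (sym (n∸n≡0 (length xs))) ⟩
    nth (x ∷ xs) (length xs ∸ length xs) ∎
    where open ≡-Reasoning

  nth-applyUpTo⁻ : ∀ (f : ℕ → A) m e {x} → nth (applyUpTo f m) e ≡ just x → e < m × x ≡ f e
  nth-applyUpTo⁻ f (suc m) zero refl = s≤s z≤n , refl
  nth-applyUpTo⁻ f (suc m) (suc e) eq =
    let e<m , x≡ = nth-applyUpTo⁻ (λ i → f (suc i)) m e eq in s≤s e<m , x≡

  nth⇒∈ : ∀ (xs : List A) q {v} → nth xs q ≡ just v → v ∈ xs
  nth⇒∈ (x ∷ xs) zero refl = here refl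
  nth⇒∈ (x ∷ xs) (suc q) eq = there (nth⇒∈ xs q eq)

  take-∷ʳ : ∀ (xs : List A) q {x} → nth xs q ≡ just x → take (suc q) xs ≡ take q xs ++ [ x ]
  take-∷ʳ (y ∷ xs) zero refl = refl
  take-∷ʳ (y ∷ xs) (suc q) eq = cong (y ∷_) (take-∷ʳ xs q eq)

  take-beyond : ∀ (xs : List A) q → nth xs q ≡ nothing → take (suc q) xs ≡ take q xs
  take-beyond [] zero _ = refl
  take-beyond [] (suc q) _ = refl
  take-beyond (y ∷ xs) (suc q) eq = cong (y ∷_) (take-beyond xs q eq)

module _ {A B : Set} where

  nth-map⁻ : ∀ (f : A → B) xs e {y} → nth (map f xs) e ≡ just y → ∃ λ x → nth xs e ≡ just x × f x ≡ y
  nth-map⁻ f (x ∷ xs) zero refl = x , refl , refl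
  nth-map⁻ f (x ∷ xs) (suc e) eq = nth-map⁻ f xs e eq

nth-indexOf : ∀ {v} (xs : List ℕ) → v ∈ xs → nth xs (indexOf v xs) ≡ just v
nth-indexOf {v} (x ∷ xs) v∈ with x ≡ᵇ v in x≡ᵇv
... | true = cong just (≡ᵇ≡true⇒≡ x v x≡ᵇv)
nth-indexOf {v} (x ∷ xs) (here refl) | false = ⊥-elim (subst T x≡ᵇv (≡⇒≡ᵇ v v refl))
nth-indexOf {v} (x ∷ xs) (there v∈) | false = nth-indexOf xs v∈

indexOf-∉ : ∀ {v} (xs : List ℕ) → v ∉ xs → indexOf v xs ≡ length xs
indexOf-∉ [] _ = refl
indexOf-∉ {v} (x ∷ xs) v∉ with x ≡ᵇ v in x≡ᵇv
... | true = ⊥-elim (v∉ (here (sym (≡ᵇ≡true⇒≡ x v x≡ᵇv))))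
... | false = cong suc (indexOf-∉ xs (λ v∈ → v∉ (there v∈)))

indexOf-nth : ∀ {v} (xs : List ℕ) → Unique xs → ∀ q → nth xs q ≡ just v → indexOf v xs ≡ q
indexOf-nth (x ∷ xs) _ zero refl rewrite ≡ᵇ-refl x = refl
indexOf-nth {v} (x ∷ xs) (x∉xs ∷ unique) (suc q) eq with x ≡ᵇ v in x≡ᵇv
... | true = ⊥-elim (All.lookup x∉xs (nth⇒∈ xs q eq) (≡ᵇ≡true⇒≡ x v x≡ᵇv))
... | false = cong suc (indexOf-nth xs unique q eq)

-- For b ranging over the prefixes of pre ++ w, X(pre ++ take (suc e) w) is the first X(b) with a 1 at
-- the e-th position of ps (see wordPerm-inverse).
FirstHits : List ℕ → List ℕ → List (ℕ × ℕ) → Set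
FirstHits pre w ps = ∀ e row col → nth ps e ≡ just (row , col) →
  Avoids (pre ++ take e w) col row × wordPerm⁻¹ (pre ++ take (suc e) w) col ≡ row

firstHits-[] : ∀ pre w → FirstHits pre w []
firstHits-[] pre w e row col ()

firstHits-++ : ∀ pre w₁ ps₁ w₂ ps₂ → length w₁ ≡ length ps₁ →
  FirstHits pre w₁ ps₁ → FirstHits (pre ++ w₁) w₂ ps₂ → FirstHits pre (w₁ ++ w₂) (ps₁ ++ ps₂)
firstHits-++ pre w₁ ps₁ w₂ ps₂ len hits₁ hits₂ e row col eq with e <? length w₁
... | yes e<len
  rewrite take-++ˡ w₁ w₂ e (<⇒≤ e<len) | take-++ˡ w₁ w₂ (suc e) e<len =
  hits₁ e row col (trans (sym (nth-++ˡ ps₁ ps₂ e (subst (e <_) len e<len))) eq)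
... | no e≮len with m≤n⇒∃[o]m+o≡n (≮⇒≥ e≮len)
... | e′ , refl
  rewrite sym (+-suc (length w₁) e′) | take-++ʳ w₁ w₂ e′ | take-++ʳ w₁ w₂ (suc e′)
        | sym (++-assoc pre w₁ (take e′ w₂)) | sym (++-assoc pre w₁ (take (suc e′) w₂)) =
  hits₂ e′ row col (trans (sym (nth-++ʳ ps₁ ps₂ e′)) (subst (λ k → nth (ps₁ ++ ps₂) (k + e′) ≡ just (row , col)) len eq))

firstHits-column : ∀ pre hi len col → col ≡ suc hi → len ≤ hi →
  wordPerm⁻¹ pre col ≡ col → (∀ r → r < col → Avoids pre col r) →
  FirstHits pre (decRun hi len) (map (λ i → (i , col)) (decRun hi len))
firstHits-column pre hi len .(suc hi) refl len≤hi returns avoids e row col eq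
  with nth-map⁻ (λ i → (i , suc hi)) (decRun hi len) e eq
... | x , nth≡x , refl with nth-decRun⁻ hi len e x nth≡x
... | e<len , refl
  rewrite take-decRun hi len e (<⇒≤ e<len) | take-decRun hi len (suc e) e<len
        | wordPerm⁻¹-++ pre (decRun hi (suc e)) (suc hi) | returns =
  avoids-++ pre (decRun hi e) (suc hi) (hi ∸ e) (avoids (hi ∸ e) (s≤s (m∸n≤m hi e)))
    (subst (λ y → Avoids (decRun hi e) y (hi ∸ e)) (sym returns) run-avoids)
  , proj₁ (decRun-top hi (suc e) (≤-trans e<len len≤hi))
  where
  e≤hi : e ≤ hi
  e≤hi = ≤-trans (<⇒≤ e<len) len≤hi
  run-avoids : Avoids (decRun hi e) (suc hi) (hi ∸ e)
  run-avoids = falls⇒avoids-below (decRun hi e) (decRun-top hi e e≤hi)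
    (subst (hi ∸ e <_) (sym (+-∸-assoc 1 e≤hi)) ≤-refl)

-- Counting over intervals

range : ℕ → ℕ → List ℕ
range lo zero = []
range lo (suc k) = lo ∷ range (suc lo) k

length-range : ∀ lo k → length (range lo k) ≡ k
length-range lo zero = refl
length-range lo (suc k) = cong suc (length-range (suc lo) k)

range-++ : ∀ lo k₁ k₂ → range lo (k₁ + k₂) ≡ range lo k₁ ++ range (lo + k₁) k₂
range-++ lo zero k₂ rewrite +-identityʳ lo = refl
range-++ lo (suc k₁) k₂ rewrite +-suc lo k₁ = cong (lo ∷_) (range-++ (suc lo) k₁ k₂)

range-∷ʳ : ∀ lo k → range lo (suc k) ≡ range lo k ++ [ lo + k ]
range-∷ʳ lo k = trans (cong (range lo) (+-comm 1 k)) (range-++ lo k 1)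

range-from : ∀ lo hi → lo ≤ hi → range lo (suc hi ∸ lo) ≡ lo ∷ range (suc lo) (hi ∸ lo)
range-from lo hi lo≤hi = cong (range lo) (+-∸-assoc 1 lo≤hi)

reverse-range : ∀ lo k → reverse (range lo k) ≡ decRun (lo + k ∸ 1) k
reverse-range lo zero = refl
reverse-range lo (suc k) = begin
  reverse (lo ∷ range (suc lo) k)           ≡⟨ unfold-reverse lo (range (suc lo) k) ⟩
  reverse (range (suc lo) k) ++ [ lo ]      ≡⟨ cong (_++ [ lo ]) (reverse-range (suc lo) k) ⟩
  decRun (lo + k) k ++ [ lo ]               ≡⟨ cong (λ x → decRun (lo + k) k ++ [ x ]) (sym (m+n∸n≡m lo k)) ⟩
  decRun (lo + k) k ++ decRun (lo + k ∸ k) 1 ≡⟨ sym (decRun-++ (lo + k) k 1) ⟩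
  decRun (lo + k) (k + 1)                   ≡⟨ cong₂ decRun (cong (_∸ 1) (sym (+-suc lo k))) (+-comm k 1) ⟩
  decRun (lo + suc k ∸ 1) (suc k)           ∎
  where open ≡-Reasoning

filterᵇ-reverse : ∀ (p : ℕ → Bool) xs → filterᵇ p (reverse xs) ≡ reverse (filterᵇ p xs)
filterᵇ-reverse p [] = refl
filterᵇ-reverse p (x ∷ xs) = begin
  filterᵇ p (reverse (x ∷ xs))                    ≡⟨ cong (filterᵇ p) (unfold-reverse x xs) ⟩
  filterᵇ p (reverse xs ++ [ x ])                 ≡⟨ filter-++ (λ y → T? (p y)) (reverse xs) [ x ] ⟩
  filterᵇ p (reverse xs) ++ filterᵇ p [ x ]       ≡⟨ cong (_++ filterᵇ p [ x ]) (filterᵇ-reverse p xs) ⟩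
  reverse (filterᵇ p xs) ++ filterᵇ p [ x ]       ≡⟨ last-step ⟩
  reverse (filterᵇ p (x ∷ xs))                    ∎
  where
  open ≡-Reasoning
  last-step : reverse (filterᵇ p xs) ++ filterᵇ p [ x ] ≡ reverse (filterᵇ p (x ∷ xs))
  last-step with p x
  ... | true = sym (unfold-reverse x (filterᵇ p xs))
  ... | false = ++-identityʳ _

count : (ℕ → Bool) → List ℕ → ℕ
count p xs = length (filterᵇ p xs)

count-∷ : ∀ p x xs → count p (x ∷ xs) ≡ (if p x then 1 else 0) + count p xs
count-∷ p x xs with p x
... | true = refl
... | false = refl

count-++ : ∀ p xs ys → count p (xs ++ ys) ≡ count p xs + count p ys
count-++ p xs ys = trans (cong length (filter-++ (λ y → T? (p y)) xs ys)) (length-++ (filterᵇ p xs))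

count-≤ : ∀ p xs → count p xs ≤ length xs
count-≤ p = length-filter (λ y → T? (p y))

count-reverse : ∀ p xs → count p (reverse xs) ≡ count p xs
count-reverse p xs = ↭.↭-length (↭.filter-↭ (λ y → T? (p y)) (↭.↭-reverse xs))

count-complement : ∀ p xs → count p xs + count (λ i → if p i then false else true) xs ≡ length xs
count-complement p [] = refl
count-complement p (x ∷ xs) with p x
... | true = cong suc (count-complement p xs)
... | false = trans (+-suc _ _) (cong suc (count-complement p xs))

count-range-none : ∀ p lo k → (∀ i → lo ≤ i → i < lo + k → p i ≡ false) → count p (range lo k) ≡ 0
count-range-none p lo zero _ = refl
count-range-none p lo (suc k) none rewrite none lo ≤-refl (m<m+n lo (s≤s z≤n)) =
  count-range-none p (suc lo) k
    (λ i lo<i i<hi → none i (≤-trans (n≤1+n lo) lo<i) (subst (i <_) (sym (+-suc lo k)) i<hi))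

count-range-all : ∀ p lo k → (∀ i → lo ≤ i → i < lo + k → p i ≡ true) → count p (range lo k) ≡ k
count-range-all p lo zero _ = refl
count-range-all p lo (suc k) all rewrite all lo ≤-refl (m<m+n lo (s≤s z≤n)) =
  cong suc (count-range-all p (suc lo) k
    (λ i lo<i i<hi → all i (≤-trans (n≤1+n lo) lo<i) (subst (i <_) (sym (+-suc lo k)) i<hi)))

count-range-split : ∀ p lo mid hi → lo ≤ mid → mid ≤ hi →
  count p (range lo (hi ∸ lo)) ≡ count p (range lo (mid ∸ lo)) + count p (range mid (hi ∸ mid))
count-range-split p lo mid hi lo≤mid mid≤hi with m≤n⇒∃[o]m+o≡n lo≤mid | m≤n⇒∃[o]m+o≡n mid≤hi
... | a , refl | b , refl
  rewrite m+n∸m≡n lo a | m+n∸m≡n (lo + a) b | +-assoc lo a b | m+n∸m≡n lo (a + b) =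
  trans (cong (count p) (range-++ lo a b)) (count-++ p (range lo a) (range (lo + a) b))

applyUpTo-range : ∀ (f : ℕ → ℕ) lo k → (∀ i → f i ≡ lo + i) → applyUpTo f k ≡ range lo k
applyUpTo-range f lo zero _ = refl
applyUpTo-range f lo (suc k) f≡ =
  cong₂ _∷_ (trans (f≡ 0) (+-identityʳ lo)) (applyUpTo-range (λ i → f (suc i)) (suc lo) k (λ i → trans (f≡ (suc i)) (+-suc lo i)))

twoToN≡range : ∀ m → twoToN (suc m) ≡ range 2 m
twoToN≡range m = trans (map-upTo (λ k → 2 + k) m) (applyUpTo-range (λ k → 2 + k) 2 m (λ _ → refl))

length-concatMap-runs : ∀ (f : ℕ → List ℕ) → (∀ x → length (f x) ≡ x ∸ 1) → ∀ xs → length (concatMap f xs) ≡ sum (map (_∸ 1) xs)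
length-concatMap-runs f length-f [] = refl
length-concatMap-runs f length-f (x ∷ xs) =
  trans (length-++ (f x)) (cong₂ _+_ (length-f x) (length-concatMap-runs f length-f xs))

sum-filter-complement : ∀ (f : ℕ → ℕ) p xs →
  sum (map f (filterᵇ p xs)) + sum (map f (filterᵇ (λ i → if p i then false else true) xs)) ≡ sum (map f xs)
sum-filter-complement f p [] = refl
sum-filter-complement f p (x ∷ xs) with p x
... | true = trans (+-assoc (f x) _ _) (cong (f x +_) (sum-filter-complement f p xs))
... | false = begin
  sum (map f (filterᵇ p xs)) + (f x + sum (map f (filterᵇ p′ xs)))   ≡⟨ swap (sum (map f (filterᵇ p xs))) (f x) (sum (map f (filterᵇ p′ xs))) ⟩
  f x + (sum (map f (filterᵇ p xs)) + sum (map f (filterᵇ p′ xs)))   ≡⟨ cong (f x +_) (sum-filter-complement f p xs) ⟩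
  f x + sum (map f xs) ∎
  where
  open ≡-Reasoning
  p′ : ℕ → Bool
  p′ i = if p i then false else true
  swap : ∀ a b c → a + (b + c) ≡ b + (a + c)
  swap = solve-∀

sum-range-∸1 : ∀ k → sum (map (_∸ 1) (range 2 k)) ≡ suc k C 2
sum-range-∸1 zero = refl
sum-range-∸1 (suc k) = begin
  sum (map (_∸ 1) (range 2 (suc k)))             ≡⟨ cong (λ xs → sum (map (_∸ 1) xs)) (range-∷ʳ 2 k) ⟩
  sum (map (_∸ 1) (range 2 k ++ [ 2 + k ]))      ≡⟨ cong sum (map-++ (_∸ 1) (range 2 k) [ 2 + k ]) ⟩
  sum (map (_∸ 1) (range 2 k) ++ [ suc k ])      ≡⟨ sum-++ (map (_∸ 1) (range 2 k)) [ suc k ] ⟩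
  sum (map (_∸ 1) (range 2 k)) + (suc k + 0)     ≡⟨ cong₂ _+_ (sum-range-∸1 k) (+-identityʳ (suc k)) ⟩
  suc k C 2 + suc k                              ≡⟨ +-comm (suc k C 2) (suc k) ⟩
  suc k + suc k C 2                              ≡⟨ cong (_+ suc k C 2) (sym (nC1≡n (suc k))) ⟩
  suc k C 1 + suc k C 2                          ≡⟨ nCk+nC[k+1]≡[n+1]C[k+1] (suc k) 1 ⟩
  suc (suc k) C 2                                ∎
  where open ≡-Reasoning

-- Triangular systems over ℚ

vecMat : ∀ {m} → (Fin m → ℚ) → Matrix m → Fin m → ℚ
vecMat x Q s = sumF (λ j → x j *ℚ Q j s)

sumF-cong : ∀ {m} {f g : Fin m → ℚ} → (∀ j → f j ≡ g j) → sumF f ≡ sumF g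
sumF-cong {zero} _ = refl
sumF-cong {suc m} f≗g = cong₂ _+ℚ_ (f≗g Fin.zero) (sumF-cong (λ j → f≗g (Fin.suc j)))

sumF-zero : ∀ {m} {f : Fin m → ℚ} → (∀ j → f j ≡ 0ℚ) → sumF f ≡ 0ℚ
sumF-zero {zero} _ = refl
sumF-zero {suc m} f≗0 = trans (cong₂ _+ℚ_ (f≗0 Fin.zero) (sumF-zero (λ j → f≗0 (Fin.suc j)))) (ℚ.+-identityʳ 0ℚ)

+ℚ-cancelʳ : ∀ p q r → p +ℚ r ≡ q +ℚ r → p ≡ q
+ℚ-cancelʳ p q r eq = trans (sym (undo p)) (trans (cong (_+ℚ (- r)) eq) (undo q))
  where
  undo : ∀ z → (z +ℚ r) +ℚ (- r) ≡ z
  undo z = trans (ℚ.+-assoc z r (- r)) (trans (cong (z +ℚ_) (ℚ.+-inverseʳ r)) (ℚ.+-identityʳ z))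

tail : ∀ {m} → Matrix (suc m) → Matrix m
tail Q j s = Q (Fin.suc j) (Fin.suc s)

module _ {m : ℕ} (Q : Matrix (suc m)) (Q-unitri : LowerUnitri Q) where

  lowerUnitri-tail : LowerUnitri (tail Q)
  lowerUnitri-tail = (λ s → proj₁ Q-unitri (Fin.suc s)) , (λ j s j<s → proj₂ Q-unitri (Fin.suc j) (Fin.suc s) (s≤s j<s))

  vecMat-suc : ∀ x s → vecMat x Q (Fin.suc s) ≡ vecMat (λ j → x (Fin.suc j)) (tail Q) s
  vecMat-suc x s = begin
    x Fin.zero *ℚ Q Fin.zero (Fin.suc s) +ℚ rest   ≡⟨ cong (λ q → x Fin.zero *ℚ q +ℚ rest) (proj₂ Q-unitri Fin.zero (Fin.suc s) (s≤s z≤n)) ⟩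
    x Fin.zero *ℚ 0ℚ +ℚ rest                       ≡⟨ cong (_+ℚ rest) (ℚ.*-zeroʳ (x Fin.zero)) ⟩
    0ℚ +ℚ rest                                     ≡⟨ ℚ.+-identityˡ rest ⟩
    rest                                           ∎
    where
    open ≡-Reasoning
    rest = vecMat (λ j → x (Fin.suc j)) (tail Q) s

  vecMat-zero : ∀ x → vecMat x Q Fin.zero ≡ x Fin.zero +ℚ sumF (λ j → x (Fin.suc j) *ℚ Q (Fin.suc j) Fin.zero)
  vecMat-zero x = cong (_+ℚ sumF (λ j → x (Fin.suc j) *ℚ Q (Fin.suc j) Fin.zero))
    (trans (cong (x Fin.zero *ℚ_) (proj₁ Q-unitri Fin.zero)) (ℚ.*-identityʳ (x Fin.zero)))

vecMat-solvable : ∀ {m} (Q : Matrix m) → LowerUnitri Q → (o : Fin m → ℚ) → Σ (Fin m → ℚ) (λ x → ∀ s → vecMat x Q s ≡ o s)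
vecMat-solvable {zero} Q _ o = (λ ()) , (λ ())
vecMat-solvable {suc m} Q Q-unitri o = x , solves
  where
  tail-solution = vecMat-solvable (tail Q) (lowerUnitri-tail Q Q-unitri) (λ s → o (Fin.suc s))
  x′ = proj₁ tail-solution
  below : ℚ
  below = sumF (λ j → x′ j *ℚ Q (Fin.suc j) Fin.zero)
  x : Fin (suc m) → ℚ
  x Fin.zero = o Fin.zero -ℚ below
  x (Fin.suc j) = x′ j
  solves : ∀ s → vecMat x Q s ≡ o s
  solves Fin.zero = trans (vecMat-zero Q Q-unitri x)
    (trans (ℚ.+-assoc (o Fin.zero) (- below) below) (trans (cong (o Fin.zero +ℚ_) (ℚ.+-inverseˡ below)) (ℚ.+-identityʳ (o Fin.zero))))
  solves (Fin.suc s) = trans (vecMat-suc Q Q-unitri x s) (proj₂ tail-solution s)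

vecMat-injective : ∀ {m} (Q : Matrix m) → LowerUnitri Q → (x y : Fin m → ℚ) → (∀ s → vecMat x Q s ≡ vecMat y Q s) → ∀ j → x j ≡ y j
vecMat-injective {suc m} Q Q-unitri x y xQ≡yQ = same
  where
  tails-same : ∀ j → x (Fin.suc j) ≡ y (Fin.suc j)
  tails-same = vecMat-injective (tail Q) (lowerUnitri-tail Q Q-unitri) (λ j → x (Fin.suc j)) (λ j → y (Fin.suc j))
    (λ s → trans (sym (vecMat-suc Q Q-unitri x s)) (trans (xQ≡yQ (Fin.suc s)) (vecMat-suc Q Q-unitri y s)))
  same : ∀ j → x j ≡ y j
  same Fin.zero = +ℚ-cancelʳ (x Fin.zero) (y Fin.zero) _ (begin
    x Fin.zero +ℚ sumF (λ j → x (Fin.suc j) *ℚ Q (Fin.suc j) Fin.zero)  ≡⟨ sym (vecMat-zero Q Q-unitri x) ⟩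
    vecMat x Q Fin.zero                                                ≡⟨ xQ≡yQ Fin.zero ⟩
    vecMat y Q Fin.zero                                                ≡⟨ vecMat-zero Q Q-unitri y ⟩
    y Fin.zero +ℚ sumF (λ j → y (Fin.suc j) *ℚ Q (Fin.suc j) Fin.zero)
      ≡⟨ cong (y Fin.zero +ℚ_) (sumF-cong (λ j → cong (_*ℚ Q (Fin.suc j) Fin.zero) (sym (tails-same j)))) ⟩
    y Fin.zero +ℚ sumF (λ j → x (Fin.suc j) *ℚ Q (Fin.suc j) Fin.zero)  ∎)
    where open ≡-Reasoning
  same (Fin.suc j) = tails-same j

vecMat-support : ∀ {m} (Q : Matrix m) → LowerUnitri Q → (x o : Fin m → ℚ) → (∀ s → vecMat x Q s ≡ o s) →
  ∀ k → (∀ s → k < toℕ s → o s ≡ 0ℚ) → (∀ j → k < toℕ j → x j ≡ 0ℚ) × (∀ j → toℕ j ≡ k → x j ≡ o j)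
vecMat-support {zero} Q _ x o _ k _ = (λ ()) , (λ ())
vecMat-support {suc m} Q Q-unitri x o solves k o-vanishes = beyond k o-vanishes , at k o-vanishes
  where
  x′ : Fin m → ℚ
  x′ j = x (Fin.suc j)
  tail-solves : ∀ s → vecMat x′ (tail Q) s ≡ o (Fin.suc s)
  tail-solves s = trans (sym (vecMat-suc Q Q-unitri x s)) (solves (Fin.suc s))
  tail-zero : (∀ s → 0 < toℕ s → o s ≡ 0ℚ) → ∀ j → x′ j ≡ 0ℚ
  tail-zero o-vanishes = vecMat-injective (tail Q) (lowerUnitri-tail Q Q-unitri) x′ (λ _ → 0ℚ)
    (λ s → trans (tail-solves s) (trans (o-vanishes (Fin.suc s) (s≤s z≤n)) (sym (sumF-zero (λ j → ℚ.*-zeroˡ (tail Q j s))))))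
  tail-support : ∀ k → (∀ s → suc k < toℕ s → o s ≡ 0ℚ) →
    (∀ j → k < toℕ j → x′ j ≡ 0ℚ) × (∀ j → toℕ j ≡ k → x′ j ≡ o (Fin.suc j))
  tail-support k o-vanishes = vecMat-support (tail Q) (lowerUnitri-tail Q Q-unitri) x′ (λ s → o (Fin.suc s)) tail-solves k
    (λ s k<s → o-vanishes (Fin.suc s) (s≤s k<s))
  beyond : ∀ k → (∀ s → k < toℕ s → o s ≡ 0ℚ) → ∀ j → k < toℕ j → x j ≡ 0ℚ
  beyond zero o-vanishes (Fin.suc j) _ = tail-zero o-vanishes j
  beyond (suc k) o-vanishes (Fin.suc j) (s≤s k<j) = proj₁ (tail-support k o-vanishes) j k<j
  at : ∀ k → (∀ s → k < toℕ s → o s ≡ 0ℚ) → ∀ j → toℕ j ≡ k → x j ≡ o j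
  at zero o-vanishes Fin.zero _ = begin
    x Fin.zero                                                     ≡⟨ sym (ℚ.+-identityʳ (x Fin.zero)) ⟩
    x Fin.zero +ℚ 0ℚ                                               ≡⟨ cong (x Fin.zero +ℚ_) (sym (sumF-zero rest-zero)) ⟩
    x Fin.zero +ℚ sumF (λ j → x′ j *ℚ Q (Fin.suc j) Fin.zero)      ≡⟨ sym (vecMat-zero Q Q-unitri x) ⟩
    vecMat x Q Fin.zero                                            ≡⟨ solves Fin.zero ⟩
    o Fin.zero                                                     ∎
    where
    open ≡-Reasoning
    rest-zero : ∀ j → x′ j *ℚ Q (Fin.suc j) Fin.zero ≡ 0ℚ
    rest-zero j = trans (cong (_*ℚ Q (Fin.suc j) Fin.zero) (tail-zero o-vanishes j)) (ℚ.*-zeroˡ (Q (Fin.suc j) Fin.zero))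
  at (suc k) o-vanishes (Fin.suc j) j≡k = proj₂ (tail-support k o-vanishes) j (cong pred j≡k)

-- The head of R_c

lowerRun : ℕ → List ℕ
lowerRun d = decRun (d ∸ 1) (d ∸ 1)

lowerRun-below : ∀ h v → 1 ≤ v → v ≤ h → Rises (lowerRun (suc h)) v (suc v)
lowerRun-below h v 1≤v v≤h = decRun-inside h h v ≤-refl v≤h (+-monoˡ-≤ h 1≤v)

lowerRun-above : ∀ d v → d < v → Rises (lowerRun d) v v
lowerRun-above zero v _ = rises-[] v
lowerRun-above (suc h) v d<v = decRun-outside h h v ≤-refl (inj₂ d<v)

lowerRun-at : ∀ h → Falls (lowerRun (suc h)) (suc h) 1
lowerRun-at h = let end , ds = decRun-top h h ≤-refl in trans end (m+n∸n≡m 1 h) , ds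

module _ (lb : ℕ → Bool) where

  lowerWord : ℕ → ℕ → List ℕ
  lowerWord lo k = concatMap lowerRun (filterᵇ lb (range lo k))

  lowerWord-below : ∀ k lo v → 1 ≤ v → v < lo → Rises (lowerWord lo k) v (v + count lb (range lo k))
  lowerWord-below zero lo v _ _ = subst (Rises [] v) (sym (+-identityʳ v)) (rises-[] v)
  lowerWord-below (suc k) (suc h) v 1≤v (s≤s v≤h) with lb (suc h)
  ... | false = lowerWord-below k (suc (suc h)) v 1≤v (s≤s (m≤n⇒m≤1+n v≤h))
  ... | true = subst (Rises _ v) (sym (+-suc v _))
    (rises-++ (lowerRun (suc h)) _ (lowerRun-below h v 1≤v v≤h)
      (lowerWord-below k (suc (suc h)) (suc v) (s≤s z≤n) (s≤s (s≤s v≤h))))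

  lowerWord-unbarred : ∀ k lo v → 1 ≤ v → lo ≤ v → (v < lo + k → lb v ≡ false) →
    Rises (lowerWord lo k) v (v + count lb (range (suc v) (lo + k ∸ suc v)))
  lowerWord-unbarred zero lo v _ lo≤v _
    rewrite +-identityʳ lo | m≤n⇒m∸n≡0 (m≤n⇒m≤1+n lo≤v) | +-identityʳ v = rises-[] v
  lowerWord-unbarred (suc k) lo v 1≤v lo≤v unbarred with m≤n⇒m<n∨m≡n lo≤v
  ... | inj₂ refl rewrite unbarred (m<m+n lo (s≤s z≤n)) | +-suc lo k | m+n∸m≡n lo k =
    lowerWord-below k (suc lo) lo 1≤v (n<1+n lo)
  ... | inj₁ lo<v rewrite +-suc lo k with lb lo
  ...   | false = lowerWord-unbarred k (suc lo) v 1≤v lo<v unbarred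
  ...   | true = rises-++ (lowerRun lo) _ (lowerRun-above lo v lo<v)
    (lowerWord-unbarred k (suc lo) v 1≤v lo<v unbarred)

  lowerWord-barred : ∀ k lo v → 1 ≤ v → lo ≤ v → v < lo + k → lb v ≡ true →
    wordPerm⁻¹ (lowerWord lo k) v ≡ suc (count lb (range (suc v) (lo + k ∸ suc v))) × Dips (lowerWord lo k) v
  lowerWord-barred zero lo v _ lo≤v v<lo _ = ⊥-elim (<⇒≱ (subst (v <_) (+-identityʳ lo) v<lo) lo≤v)
  lowerWord-barred (suc k) lo v 1≤v lo≤v v<hi barred with m≤n⇒m<n∨m≡n lo≤v
  lowerWord-barred (suc k) zero .zero () _ _ _ | inj₂ refl
  lowerWord-barred (suc k) (suc h) .(suc h) _ _ _ barred | inj₂ refl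
    rewrite barred | +-suc h k | m+n∸m≡n h k =
    ends-++ (lowerRun (suc h)) _ (proj₁ falls) (proj₁ rises) ,
    falls-++-rises⇒dips (lowerRun (suc h)) _ falls rises
    where
    falls = lowerRun-at h
    rises = lowerWord-below k (suc (suc h)) 1 ≤-refl (s≤s (s≤s z≤n))
  ... | inj₁ lo<v rewrite +-suc lo k with lb lo
  ...   | false = lowerWord-barred k (suc lo) v 1≤v lo<v v<hi barred
  ...   | true = let end , dips = lowerWord-barred k (suc lo) v 1≤v lo<v v<hi barred in
    ends-++ (lowerRun lo) _ (proj₁ fixed) end , fixes-++-dips (lowerRun lo) _ fixed dips
    where
    fixed = lowerRun-above lo v lo<v

  lowerWord-above : ∀ k lo v → lo + k ≤ v → Rises (lowerWord lo k) v v
  lowerWord-above zero lo v _ = rises-[] v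
  lowerWord-above (suc k) lo v lo+k<v rewrite +-suc lo k with lb lo
  ... | false = lowerWord-above k (suc lo) v lo+k<v
  ... | true = rises-++ (lowerRun lo) _ (lowerRun-above lo v (≤-trans (s≤s (m≤m+n lo k)) lo+k<v))
    (lowerWord-above k (suc lo) v lo+k<v)

  lowerWord-∷ʳ : ∀ lo k → lowerWord lo (suc k) ≡ lowerWord lo k ++ concatMap lowerRun (filterᵇ lb [ lo + k ])
  lowerWord-∷ʳ lo k = begin
    concatMap lowerRun (filterᵇ lb (range lo (suc k)))             ≡⟨ cong (λ xs → concatMap lowerRun (filterᵇ lb xs)) (range-∷ʳ lo k) ⟩
    concatMap lowerRun (filterᵇ lb (range lo k ++ [ lo + k ]))     ≡⟨ cong (concatMap lowerRun) (filter-++ (λ y → T? (lb y)) (range lo k) [ lo + k ]) ⟩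
    concatMap lowerRun (filterᵇ lb (range lo k) ++ filterᵇ lb [ lo + k ]) ≡⟨ concatMap-++ lowerRun (filterᵇ lb (range lo k)) _ ⟩
    lowerWord lo k ++ concatMap lowerRun (filterᵇ lb [ lo + k ])    ∎
    where open ≡-Reasoning

lowerColumn : ℕ → List (ℕ × ℕ)
lowerColumn d = map (λ i → (i , d)) (lowerRun d)

length-lowerColumns : ∀ ds → length (concatMap lowerRun ds) ≡ length (concatMap lowerColumn ds)
length-lowerColumns [] = refl
length-lowerColumns (d ∷ ds)
  rewrite length-++ (lowerRun d) {concatMap lowerRun ds} | length-++ (lowerColumn d) {concatMap lowerColumn ds}
        | length-map (λ i → (i , d)) (lowerRun d) | length-lowerColumns ds = refl

-- lb stands for the lower-barred predicate and headWord for the head of R_c; n = suc m makes n ∸ 1 compute.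
module Head (lb : ℕ → Bool) (m : ℕ) where

  n : ℕ
  n = suc m

  barredAbove : ℕ → ℕ
  barredAbove v = count lb (range (suc v) (n ∸ v))

  dWord : List ℕ
  dWord = lowerWord lb 2 m

  headWord : List ℕ
  headWord = dWord ++ decRun n n

  level : ℕ → ℕ
  level v = wordPerm⁻¹ headWord v

  barredAbove-bound : ∀ v → v ≤ n → v + barredAbove v ≤ n
  barredAbove-bound v v≤n = begin
    v + barredAbove v               ≤⟨ +-monoʳ-≤ v (count-≤ lb (range (suc v) (n ∸ v))) ⟩
    v + length (range (suc v) (n ∸ v)) ≡⟨ cong (v +_) (length-range (suc v) (n ∸ v)) ⟩
    v + (n ∸ v)                     ≡⟨ m+[n∸m]≡n v≤n ⟩
    n                               ∎
    where open ≤-Reasoning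

  nRun-shift : ∀ w → 1 ≤ w → w ≤ n → Rises (decRun n n) w (suc w)
  nRun-shift w 1≤w w≤n = decRun-inside n n w ≤-refl w≤n (+-monoˡ-≤ n 1≤w)

  dWord-unbarred : ∀ v → 1 ≤ v → v ≤ n → (2 ≤ v → lb v ≡ false) → Rises dWord v (v + barredAbove v)
  dWord-unbarred (suc zero) _ _ _ = lowerWord-below lb m 2 1 ≤-refl ≤-refl
  dWord-unbarred (suc (suc v)) 1≤v v≤n unbarred =
    lowerWord-unbarred lb m 2 (suc (suc v)) 1≤v (s≤s (s≤s z≤n)) (λ _ → unbarred (s≤s (s≤s z≤n)))

  level-unbarred : ∀ v → 1 ≤ v → v ≤ n → (2 ≤ v → lb v ≡ false) → Rises headWord v (suc (v + barredAbove v))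
  level-unbarred v 1≤v v≤n unbarred = rises-++ dWord (decRun n n) (dWord-unbarred v 1≤v v≤n unbarred)
    (nRun-shift (v + barredAbove v) (≤-trans 1≤v (m≤m+n v _)) (barredAbove-bound v v≤n))

  level-barred : ∀ v → 2 ≤ v → v ≤ n → lb v ≡ true → level v ≡ suc (suc (barredAbove v)) × Dips headWord v
  level-barred v 2≤v v≤n barred =
    ends-++ dWord (decRun n n) dEnd (proj₁ shift) ,
    dips-++-rises dWord (decRun n n) dDips (subst (λ y → Rises (decRun n n) y (suc (suc (barredAbove v)))) (sym dEnd) shift)
    where
    1≤v = ≤-trans (s≤s z≤n) 2≤v
    dWord-barred = lowerWord-barred lb m 2 v 1≤v 2≤v (s≤s v≤n) barred
    dEnd = proj₁ dWord-barred
    dDips = proj₂ dWord-barred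
    shift = nRun-shift (suc (barredAbove v)) (s≤s z≤n)
              (≤-trans (+-monoˡ-≤ (barredAbove v) 1≤v) (barredAbove-bound v v≤n))

  dWord-top : Rises dWord (suc n) (suc n)
  dWord-top = lowerWord-above lb m 2 (suc n) ≤-refl

  level-top : level (suc n) ≡ 1
  level-top = ends-++ dWord (decRun n n) (proj₁ dWord-top) (trans (proj₁ (decRun-top n n ≤-refl)) (m+n∸n≡m 1 n))

  lowerColumns : ℕ → ℕ → List (ℕ × ℕ)
  lowerColumns lo k = concatMap lowerColumn (filterᵇ lb (range lo k))

  lowerColumns-firstHits : ∀ k j → FirstHits (lowerWord lb 2 j) (lowerWord lb (2 + j) k) (lowerColumns (2 + j) k)
  lowerColumns-firstHits zero j = firstHits-[] _ _
  lowerColumns-firstHits (suc k) j with lb (2 + j) | lowerWord-∷ʳ lb 2 j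
  ... | false | snoc = subst (λ pre → FirstHits pre (lowerWord lb (3 + j) k) (lowerColumns (3 + j) k))
    (trans snoc (++-identityʳ _)) (lowerColumns-firstHits k (suc j))
  ... | true | snoc = firstHits-++ (lowerWord lb 2 j) (lowerRun (2 + j)) (lowerColumn (2 + j))
    (lowerWord lb (3 + j) k) (lowerColumns (3 + j) k)
    (sym (length-map (λ i → (i , 2 + j)) (lowerRun (2 + j))))
    (firstHits-column (lowerWord lb 2 j) (suc j) (suc j) (2 + j) refl ≤-refl (proj₁ fixed)
      (λ r r<col → rises⇒avoids-below (lowerWord lb 2 j) fixed r<col))
    (subst (λ pre → FirstHits pre (lowerWord lb (3 + j) k) (lowerColumns (3 + j) k))
      (trans snoc (cong (lowerWord lb 2 j ++_) (++-identityʳ _)))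
      (lowerColumns-firstHits k (suc j)))
    where
    fixed = lowerWord-above lb j 2 (2 + j) ≤-refl

  headColumns : List (ℕ × ℕ)
  headColumns = lowerColumns 2 m ++ map (λ i → (i , n + 1)) (decRun n n)

  headWord-firstHits : FirstHits [] headWord headColumns
  headWord-firstHits = firstHits-++ [] dWord (lowerColumns 2 m) (decRun n n) _
    (length-lowerColumns (filterᵇ lb (range 2 m))) (lowerColumns-firstHits m 0)
    (firstHits-column dWord n n (n + 1) (+-comm n 1) ≤-refl (proj₁ fixed)
      (λ r r<col → rises⇒avoids-below dWord fixed r<col))
    where
    fixed = lowerWord-above lb m 2 (n + 1) (≤-reflexive (+-comm 1 n))

module Coxeter (m : ℕ) (a : List ℕ) (a↭ : a ↭ map suc (upTo (suc m))) where

  n : ℕ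
  n = suc m

  lb : ℕ → Bool
  lb = lowerBarred a

  idx : ℕ → ℕ
  idx v = indexOf v a

  bounds⇒∈a : ∀ {v} → 1 ≤ v → v ≤ n → v ∈ a
  bounds⇒∈a {suc v} _ v<n = ↭.∈-resp-↭ (↭-sym a↭) (∈-map⁺ suc (∈-upTo⁺ v<n))

  ∈a⇒bounds : ∀ {v} → v ∈ a → 1 ≤ v × v ≤ n
  ∈a⇒bounds v∈a with ∈-map⁻ suc (↭.∈-resp-↭ a↭ v∈a)
  ... | u , u∈ , refl = s≤s z≤n , ∈-upTo⁻ u∈

  length-a : length a ≡ n
  length-a = trans (↭.↭-length a↭) (trans (length-map suc (upTo n)) (length-upTo n))

  unique-a : Unique a
  unique-a = Unique-resp-↭ (↭⇒↭ₛ (↭-sym a↭)) (Unique.map⁺ suc-injective (Unique.upTo⁺ n))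

  nth-idx : ∀ v → 1 ≤ v → v ≤ n → nth a (idx v) ≡ just v
  nth-idx v 1≤v v≤n = nth-indexOf a (bounds⇒∈a 1≤v v≤n)

  idx-nth : ∀ q {v} → nth a q ≡ just v → idx v ≡ q
  idx-nth q = indexOf-nth a unique-a q

  idx<n : ∀ v → 1 ≤ v → v ≤ n → idx v < n
  idx<n v 1≤v v≤n = subst (idx v <_) length-a (nth⇒< a (idx v) (nth-idx v 1≤v v≤n))

  idx-0 : idx 0 ≡ n
  idx-0 = trans (indexOf-∉ a (λ 0∈a → 1+n≰n (proj₁ (∈a⇒bounds 0∈a)))) length-a

  idx-top : idx (suc n) ≡ n
  idx-top = trans (indexOf-∉ a (λ top∈a → 1+n≰n (proj₂ (∈a⇒bounds top∈a)))) length-a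

  idx-pred≢ : ∀ v → 2 ≤ v → v ≤ n → idx v ≢ idx (pred v)
  idx-pred≢ (suc zero) (s≤s ()) _
  idx-pred≢ (suc (suc u)) _ v≤n idx≡ =
    1+n≢n (just-injective (trans (sym (nth-idx (suc (suc u)) (s≤s z≤n) v≤n))
                            (trans (cong (nth a) idx≡) (nth-idx (suc u) (s≤s z≤n) (≤-trans (n≤1+n _) v≤n)))))

  barred⇒idx< : ∀ v → lb v ≡ true → idx (pred v) < idx v
  barred⇒idx< v barred = <ᵇ≡true⇒< (idx (pred v)) (idx v) barred

  unbarred⇒idx> : ∀ v → 2 ≤ v → v ≤ n → lb v ≡ false → idx v < idx (pred v)
  unbarred⇒idx> v 2≤v v≤n unbarred =
    ≤∧≢⇒< (<ᵇ≡false⇒≥ (idx (pred v)) (idx v) unbarred) (idx-pred≢ v 2≤v v≤n)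

  prefixPerm : ℕ → ℕ → ℕ
  prefixPerm P v = wordPerm (take P a) v

  cox≡prefixPerm : ∀ x → cox a x ≡ prefixPerm n x
  cox≡prefixPerm x = cong (λ w → wordPerm w x) (sym (take-all n a (≤-reflexive length-a)))

  prefixPerm-hit : ∀ P {x} v → nth a P ≡ just x → prefixPerm (suc P) v ≡ prefixPerm P (s x v)
  prefixPerm-hit P {x} v eq = trans (cong (λ w → wordPerm w v) (take-∷ʳ a P eq)) (wordPerm-∷ʳ (take P a) x v)

  prefixPerm-miss : ∀ P v → 1 ≤ v → P ≢ idx v → P ≢ idx (pred v) → prefixPerm (suc P) v ≡ prefixPerm P v
  prefixPerm-miss P v 1≤v P≢v P≢pred with nth a P in eq
  ... | nothing = cong (λ w → wordPerm w v) (take-beyond a P eq)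
  ... | just x = trans (prefixPerm-hit P v eq) (cong (prefixPerm P) (s-fix x v v≢x v≢1+x))
    where
    v≢x : v ≢ x
    v≢x refl = P≢v (sym (idx-nth P eq))
    v≢1+x : v ≢ suc x
    v≢1+x refl = P≢pred (sym (idx-nth P eq))

  prefixPerm-skip : ∀ P Q v → 1 ≤ v → P ≤ Q → (∀ q → P ≤ q → q < Q → q ≢ idx v × q ≢ idx (pred v)) →
    prefixPerm Q v ≡ prefixPerm P v
  prefixPerm-skip P Q v 1≤v P≤Q untouched with m≤n⇒m<n∨m≡n P≤Q
  ... | inj₂ refl = refl
  prefixPerm-skip P (suc Q) v 1≤v _ untouched | inj₁ (s≤s P≤Q) =
    let Q≢v , Q≢pred = untouched Q P≤Q ≤-refl in
    trans (prefixPerm-miss Q v 1≤v Q≢v Q≢pred)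
          (prefixPerm-skip P Q v 1≤v P≤Q (λ q P≤q q<Q → untouched q P≤q (m<n⇒m<1+n q<Q)))

  record NextLower (y z : ℕ) : Set where
    constructor nextLower
    field
      y≤z : y ≤ z
      z≤1+n : z ≤ suc n
      unbarred-between : ∀ i → y ≤ i → i < z → lb i ≡ false
      barred-or-top : z ≡ suc n ⊎ (z ≤ n × lb z ≡ true)

  record PrevUpper (y z : ℕ) : Set where
    constructor prevUpper
    field
      1≤z : 1 ≤ z
      z≤y : z ≤ y
      barred-between : ∀ i → z < i → i ≤ y → lb i ≡ true
      unbarred-or-1 : z ≡ 1 ⊎ (2 ≤ z × lb z ≡ false)

  climb : ∀ k x → x + k ≡ n → 1 ≤ x → NextLower (suc x) (prefixPerm (idx x) (suc x))
  climb zero x x+0≡n 1≤x rewrite +-identityʳ x | x+0≡n =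
    subst (NextLower (suc n)) (sym fixed) (nextLower ≤-refl ≤-refl (λ i n<i i<n → ⊥-elim (<⇒≱ i<n n<i)) (inj₁ refl))
    where
    fixed : prefixPerm (idx n) (suc n) ≡ suc n
    fixed = prefixPerm-skip 0 (idx n) (suc n) (s≤s z≤n) z≤n
      (λ q _ q<idx → <⇒≢ (subst (q <_) (sym idx-top) (<-trans q<idx (idx<n n (s≤s z≤n) ≤-refl))) , <⇒≢ q<idx)
  climb (suc k) x x+k≡n 1≤x with lb (suc x) in barred
  ... | true = subst (NextLower (suc x)) (sym fixed)
    (nextLower ≤-refl (≤-trans 1+x≤n (n≤1+n n)) (λ i x<i i<x → ⊥-elim (<⇒≱ i<x x<i)) (inj₂ (1+x≤n , barred)))
    where
    1+x≤n : suc x ≤ n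
    1+x≤n = subst (x <_) x+k≡n (m<m+n x (s≤s z≤n))
    fixed : prefixPerm (idx x) (suc x) ≡ suc x
    fixed = prefixPerm-skip 0 (idx x) (suc x) (s≤s z≤n) z≤n
      (λ q _ q<idx → <⇒≢ (<-trans q<idx (barred⇒idx< (suc x) barred)) , <⇒≢ q<idx)
  ... | false = subst (NextLower (suc x)) (sym moves) (extend (climb k (suc x) (trans (sym (+-suc x k)) x+k≡n) (s≤s z≤n)))
    where
    1+x≤n : suc x ≤ n
    1+x≤n = subst (x <_) x+k≡n (m<m+n x (s≤s z≤n))
    idx<idx : idx (suc x) < idx x
    idx<idx = unbarred⇒idx> (suc x) (s≤s 1≤x) 1+x≤n barred
    moves : prefixPerm (idx x) (suc x) ≡ prefixPerm (idx (suc x)) (suc (suc x))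
    moves = begin
      prefixPerm (idx x) (suc x)
        ≡⟨ prefixPerm-skip (suc (idx (suc x))) (idx x) (suc x) (s≤s z≤n) idx<idx (λ q idx<q q<idx → >⇒≢ idx<q , <⇒≢ q<idx) ⟩
      prefixPerm (suc (idx (suc x))) (suc x)
        ≡⟨ prefixPerm-hit (idx (suc x)) (suc x) (nth-idx (suc x) (s≤s z≤n) 1+x≤n) ⟩
      prefixPerm (idx (suc x)) (s (suc x) (suc x))
        ≡⟨ cong (prefixPerm (idx (suc x))) (s-at (suc x)) ⟩
      prefixPerm (idx (suc x)) (suc (suc x)) ∎
      where open ≡-Reasoning
    extend : ∀ {z} → NextLower (suc (suc x)) z → NextLower (suc x) z
    extend (nextLower y≤z z≤1+n between stop) = nextLower (≤-trans (n≤1+n _) y≤z) z≤1+n between′ stop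
      where
      between′ : ∀ i → suc x ≤ i → i < _ → lb i ≡ false
      between′ i x<i i<z with m≤n⇒m<n∨m≡n x<i
      ... | inj₁ 1+x<i = between i 1+x<i i<z
      ... | inj₂ refl = barred

  descend-step : ∀ x → suc (suc x) ≤ n → PrevUpper (suc x) (prefixPerm (idx (suc x)) (suc x)) →
    PrevUpper (suc (suc x)) (prefixPerm (idx (suc (suc x))) (suc (suc x)))
  descend-step x y≤n previous with lb (suc (suc x)) in barred
  ... | false = subst (PrevUpper (suc (suc x))) (sym fixed)
    (prevUpper (s≤s z≤n) ≤-refl (λ i y<i i≤y → ⊥-elim (<⇒≱ y<i i≤y)) (inj₂ (s≤s (s≤s z≤n) , barred)))
    where
    fixed : prefixPerm (idx (suc (suc x))) (suc (suc x)) ≡ suc (suc x)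
    fixed = prefixPerm-skip 0 (idx (suc (suc x))) (suc (suc x)) (s≤s z≤n) z≤n
      (λ q _ q<idx → <⇒≢ q<idx , <⇒≢ (<-trans q<idx (unbarred⇒idx> (suc (suc x)) (s≤s (s≤s z≤n)) y≤n barred)))
  ... | true = subst (PrevUpper (suc (suc x))) (sym moves) (extend previous)
    where
    1+x≤n : suc x ≤ n
    1+x≤n = ≤-trans (n≤1+n _) y≤n
    idx<idx : idx (suc x) < idx (suc (suc x))
    idx<idx = barred⇒idx< (suc (suc x)) barred
    moves : prefixPerm (idx (suc (suc x))) (suc (suc x)) ≡ prefixPerm (idx (suc x)) (suc x)
    moves = begin
      prefixPerm (idx (suc (suc x))) (suc (suc x))
        ≡⟨ prefixPerm-skip (suc (idx (suc x))) (idx (suc (suc x))) (suc (suc x)) (s≤s z≤n) idx<idx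
             (λ q idx<q q<idx → <⇒≢ q<idx , >⇒≢ idx<q) ⟩
      prefixPerm (suc (idx (suc x))) (suc (suc x))
        ≡⟨ prefixPerm-hit (idx (suc x)) (suc (suc x)) (nth-idx (suc x) (s≤s z≤n) 1+x≤n) ⟩
      prefixPerm (idx (suc x)) (s (suc x) (suc (suc x)))
        ≡⟨ cong (prefixPerm (idx (suc x))) (s-at-suc (suc x)) ⟩
      prefixPerm (idx (suc x)) (suc x) ∎
      where open ≡-Reasoning
    extend : ∀ {z} → PrevUpper (suc x) z → PrevUpper (suc (suc x)) z
    extend (prevUpper 1≤z z≤y between stop) = prevUpper 1≤z (≤-trans z≤y (n≤1+n _)) between′ stop
      where
      between′ : ∀ i → _ < i → i ≤ suc (suc x) → lb i ≡ true
      between′ i z<i i≤y with m≤n⇒m<n∨m≡n i≤y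
      ... | inj₁ i<y = between i z<i (≤-pred i<y)
      ... | inj₂ refl = barred

  descend : ∀ y → 1 ≤ y → y ≤ n → PrevUpper y (prefixPerm (idx y) y)
  descend (suc zero) _ 1≤n = subst (PrevUpper 1) (sym fixed)
    (prevUpper ≤-refl ≤-refl (λ i 1<i i≤1 → ⊥-elim (<⇒≱ 1<i i≤1)) (inj₁ refl))
    where
    fixed : prefixPerm (idx 1) 1 ≡ 1
    fixed = prefixPerm-skip 0 (idx 1) 1 ≤-refl z≤n
      (λ q _ q<idx → <⇒≢ q<idx , <⇒≢ (subst (q <_) (sym idx-0) (<-trans q<idx (idx<n 1 ≤-refl 1≤n))))
  descend (suc (suc x)) _ y≤n = descend-step x y≤n (descend (suc x) (s≤s z≤n) (≤-trans (n≤1+n _) y≤n))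

  cox-lower : ∀ x → 1 ≤ x → x ≤ n → (x ≡ 1 ⊎ lb x ≡ true) → NextLower (suc x) (cox a x)
  cox-lower x 1≤x x≤n first = subst (NextLower (suc x)) (sym moves) (climb (n ∸ x) x (m+[n∸m]≡n x≤n) 1≤x)
    where
    pred-untouched : (x ≡ 1 ⊎ lb x ≡ true) → ∀ q → idx x < q → q < n → q ≢ idx (pred x)
    pred-untouched (inj₁ refl) q _ q<n = <⇒≢ (subst (q <_) (sym idx-0) q<n)
    pred-untouched (inj₂ barred) q idx<q _ = >⇒≢ (<-trans (barred⇒idx< x barred) idx<q)
    moves : cox a x ≡ prefixPerm (idx x) (suc x)
    moves = begin
      cox a x                       ≡⟨ cox≡prefixPerm x ⟩
      prefixPerm n x                ≡⟨ prefixPerm-skip (suc (idx x)) n x 1≤x (idx<n x 1≤x x≤n)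
                                         (λ q idx<q q<n → >⇒≢ idx<q , pred-untouched first q idx<q q<n) ⟩
      prefixPerm (suc (idx x)) x    ≡⟨ prefixPerm-hit (idx x) x (nth-idx x 1≤x x≤n) ⟩
      prefixPerm (idx x) (s x x)    ≡⟨ cong (prefixPerm (idx x)) (s-at x) ⟩
      prefixPerm (idx x) (suc x)    ∎
      where open ≡-Reasoning

  cox-upper : ∀ x → 2 ≤ x → x ≤ n → lb x ≡ false → PrevUpper (pred x) (cox a x)
  cox-upper (suc zero) (s≤s ()) _ _
  cox-upper (suc (suc u)) 2≤x x≤n unbarred = subst (PrevUpper (suc u)) (sym moves) (descend (suc u) (s≤s z≤n) 1+u≤n)
    where
    1+u≤n : suc u ≤ n
    1+u≤n = ≤-trans (n≤1+n _) x≤n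
    idx<idx : idx (suc (suc u)) < idx (suc u)
    idx<idx = unbarred⇒idx> (suc (suc u)) 2≤x x≤n unbarred
    moves : cox a (suc (suc u)) ≡ prefixPerm (idx (suc u)) (suc u)
    moves = begin
      cox a (suc (suc u))                            ≡⟨ cox≡prefixPerm (suc (suc u)) ⟩
      prefixPerm n (suc (suc u))                     ≡⟨ prefixPerm-skip (suc (idx (suc u))) n (suc (suc u)) (s≤s z≤n)
                                                          (idx<n (suc u) (s≤s z≤n) 1+u≤n)
                                                          (λ q idx<q _ → >⇒≢ (<-trans idx<idx idx<q) , >⇒≢ idx<q) ⟩
      prefixPerm (suc (idx (suc u))) (suc (suc u))   ≡⟨ prefixPerm-hit (idx (suc u)) (suc (suc u)) (nth-idx (suc u) (s≤s z≤n) 1+u≤n) ⟩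
      prefixPerm (idx (suc u)) (s (suc u) (suc (suc u))) ≡⟨ cong (prefixPerm (idx (suc u))) (s-at-suc (suc u)) ⟩
      prefixPerm (idx (suc u)) (suc u)               ∎
      where open ≡-Reasoning

module Levels (m : ℕ) (a : List ℕ) (a↭ : a ↭ map suc (upTo (suc m))) where

  open Coxeter m a a↭ public
  open Head lb m public hiding (n)

  barredAbove-split : ∀ v w → v < w → w ≤ n →
    barredAbove v ≡ count lb (range (suc v) (w ∸ suc v)) + ((if lb w then 1 else 0) + barredAbove w)
  barredAbove-split v w v<w w≤n = begin
    barredAbove v                                  ≡⟨ count-range-split lb (suc v) w (suc n) v<w (m≤n⇒m≤1+n w≤n) ⟩
    between + count lb (range w (suc n ∸ w))       ≡⟨ cong (λ xs → between + count lb xs) (range-from w n w≤n) ⟩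
    between + count lb (w ∷ range (suc w) (n ∸ w)) ≡⟨ cong (between +_) (count-∷ lb w _) ⟩
    between + ((if lb w then 1 else 0) + barredAbove w) ∎
    where
    open ≡-Reasoning
    between = count lb (range (suc v) (w ∸ suc v))

  level-lower : ∀ x → 1 ≤ x → x ≤ n → (x ≡ 1 ⊎ lb x ≡ true) → level x ≡ suc (suc (barredAbove x))
  level-lower x _ x≤n (inj₁ refl) = proj₁ (level-unbarred 1 ≤-refl x≤n (λ { (s≤s ()) }))
  level-lower (suc zero) _ x≤n (inj₂ _) = proj₁ (level-unbarred 1 ≤-refl x≤n (λ { (s≤s ()) }))
  level-lower (suc (suc x)) _ x≤n (inj₂ barred) = proj₁ (level-barred (suc (suc x)) (s≤s (s≤s z≤n)) x≤n barred)

  level-upper : ∀ x → 1 ≤ x → x ≤ n → (x ≡ 1 ⊎ (2 ≤ x × lb x ≡ false)) → level x ≡ suc (x + barredAbove x)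
  level-upper x 1≤x x≤n (inj₁ refl) = proj₁ (level-unbarred 1 ≤-refl x≤n (λ { (s≤s ()) }))
  level-upper x 1≤x x≤n (inj₂ (_ , unbarred)) = proj₁ (level-unbarred x 1≤x x≤n (λ _ → unbarred))

  count-gap : ∀ {x z} → x < z → (∀ i → suc x ≤ i → i < z → lb i ≡ false) → count lb (range (suc x) (z ∸ suc x)) ≡ 0
  count-gap {x} {z} x<z gap =
    count-range-none lb (suc x) (z ∸ suc x) (λ i x<i i<end → gap i x<i (subst (i <_) (m+[n∸m]≡n x<z) i<end))

  level-cox-lower : ∀ x → 1 ≤ x → x ≤ n → (x ≡ 1 ⊎ lb x ≡ true) → suc (level (cox a x)) ≡ level x
  level-cox-lower x 1≤x x≤n first with cox a x | cox-lower x 1≤x x≤n first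
  ... | z | nextLower x<z _ gap (inj₁ z≡top) = begin
    suc (level z)               ≡⟨ cong (λ y → suc (level y)) z≡top ⟩
    suc (level (suc n))         ≡⟨ cong suc level-top ⟩
    suc (suc 0)                 ≡⟨ cong (λ k → suc (suc k)) (sym none-above) ⟩
    suc (suc (barredAbove x))   ≡⟨ sym (level-lower x 1≤x x≤n first) ⟩
    level x                     ∎
    where
    open ≡-Reasoning
    none-above : barredAbove x ≡ 0
    none-above = trans (cong (λ y → count lb (range (suc x) (y ∸ suc x))) (sym z≡top)) (count-gap x<z gap)
  ... | z | nextLower x<z _ gap (inj₂ (z≤top , barred)) = begin
    suc (level z)                                    ≡⟨ cong suc (proj₁ (level-barred z (≤-trans (s≤s 1≤x) x<z) z≤top barred)) ⟩
    suc (suc (suc (barredAbove z)))                  ≡⟨ cong (λ k → suc (suc k)) (sym between) ⟩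
    suc (suc (barredAbove x))                        ≡⟨ sym (level-lower x 1≤x x≤n first) ⟩
    level x                                          ∎
    where
    open ≡-Reasoning
    between : barredAbove x ≡ suc (barredAbove z)
    between rewrite barredAbove-split x z x<z z≤top | count-gap x<z gap | barred = refl

  level-cox-upper : ∀ x → 2 ≤ x → x ≤ n → lb x ≡ false → suc (level (cox a x)) ≡ level x
  level-cox-upper (suc zero) (s≤s ()) _ _
  level-cox-upper (suc (suc u)) 2≤x x≤n unbarred with cox a (suc (suc u)) | cox-upper (suc (suc u)) 2≤x x≤n unbarred
  ... | z | prevUpper 1≤z z≤1+u between stop = begin
    suc (level z)                                        ≡⟨ cong suc (level-upper z 1≤z z≤top stop) ⟩
    suc (suc (z + barredAbove z))                        ≡⟨ cong (λ k → suc (suc (z + k))) split ⟩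
    suc (suc (z + ((x ∸ suc z) + barredAbove x)))        ≡⟨ cong suc (sym (+-assoc (suc z) (x ∸ suc z) (barredAbove x))) ⟩
    suc (suc z + (x ∸ suc z) + barredAbove x)            ≡⟨ cong (λ k → suc (k + barredAbove x)) (m+[n∸m]≡n z<x) ⟩
    suc (x + barredAbove x)                              ≡⟨ sym (proj₁ (level-unbarred x (s≤s z≤n) x≤n (λ _ → unbarred))) ⟩
    level x                                              ∎
    where
    open ≡-Reasoning
    x = suc (suc u)
    z<x : z < x
    z<x = s≤s z≤1+u
    z≤top : z ≤ n
    z≤top = ≤-trans (<⇒≤ z<x) x≤n
    all-barred : count lb (range (suc z) (x ∸ suc z)) ≡ x ∸ suc z
    all-barred = count-range-all lb (suc z) (x ∸ suc z)
      (λ i z<i i<end → between i z<i (≤-pred (subst (i <_) (m+[n∸m]≡n z<x) i<end)))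
    split : barredAbove z ≡ (x ∸ suc z) + barredAbove x
    split rewrite barredAbove-split z x z<x x≤n | all-barred | unbarred = refl

  level-cox : ∀ x → 1 ≤ x → x ≤ n → 1 ≤ cox a x × cox a x ≤ suc n × suc (level (cox a x)) ≡ level x
  level-cox (suc zero) 1≤x x≤n =
    let nextLower x<z z≤1+n _ _ = cox-lower 1 1≤x x≤n (inj₁ refl) in
    ≤-trans (s≤s z≤n) x<z , z≤1+n , level-cox-lower 1 1≤x x≤n (inj₁ refl)
  level-cox (suc (suc x)) 1≤x x≤n with lb (suc (suc x)) in barred
  ... | true =
    let nextLower x<z z≤1+n _ _ = cox-lower (suc (suc x)) 1≤x x≤n (inj₂ barred) in
    ≤-trans (s≤s z≤n) x<z , z≤1+n , level-cox-lower (suc (suc x)) 1≤x x≤n (inj₂ barred)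
  ... | false =
    let prevUpper 1≤z z≤y _ _ = cox-upper (suc (suc x)) (s≤s (s≤s z≤n)) x≤n barred in
    1≤z , ≤-trans z≤y (≤-trans (n≤1+n _) (m≤n⇒m≤1+n x≤n)) , level-cox-upper (suc (suc x)) (s≤s (s≤s z≤n)) x≤n barred

  level-iter : ∀ j u → 1 ≤ u → u ≤ n → j < level u →
    1 ≤ iter (cox a) j u × iter (cox a) j u ≤ suc n × level (iter (cox a) j u) + j ≡ level u
  level-iter zero u 1≤u u≤n _ = 1≤u , m≤n⇒m≤1+n u≤n , +-identityʳ (level u)
  level-iter (suc j) u 1≤u u≤n j<level =
    1≤cy , cy≤1+n , trans (+-suc (level (cox a y)) j) (trans (cong (_+ j) cy-level) y-level)
    where
    previous = level-iter j u 1≤u u≤n (<-trans (n<1+n j) j<level)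
    y = iter (cox a) j u
    y-level : level y + j ≡ level u
    y-level = proj₂ (proj₂ previous)
    y≤n : y ≤ n
    y≤n with m≤n⇒m<n∨m≡n (proj₁ (proj₂ previous))
    ... | inj₁ y<1+n = ≤-pred y<1+n
    ... | inj₂ y≡top = ⊥-elim (<-irrefl (trans (sym (cong (_+ j) (trans (cong level y≡top) level-top))) y-level) j<level)
    next = level-cox y (proj₁ previous) y≤n
    1≤cy = proj₁ next
    cy≤1+n = proj₁ (proj₂ next)
    cy-level = proj₂ (proj₂ next)

  headWord-avoids : ∀ x r → 1 ≤ x → x ≤ n → level x < r → (2 ≤ x → lb x ≡ true → x < r) → Avoids headWord x r
  headWord-avoids (suc zero) r _ x≤n level<r _ =
    let rises = level-unbarred 1 ≤-refl x≤n (λ { (s≤s ()) }) in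
    rises⇒avoids-above headWord rises (subst (_< r) (proj₁ rises) level<r)
  headWord-avoids (suc (suc x)) r 1≤x x≤n level<r x<r with lb (suc (suc x)) in barred
  ... | true = proj₂ (level-barred (suc (suc x)) (s≤s (s≤s z≤n)) x≤n barred) r (x<r (s≤s (s≤s z≤n)) refl) level<r
  ... | false =
    let rises = level-unbarred (suc (suc x)) 1≤x x≤n (λ _ → barred) in
    rises⇒avoids-above headWord rises (subst (_< r) (proj₁ rises) level<r)

  level-gap : ∀ u x → 1 ≤ u → u < x → x ≤ n → (u ≡ 1 ⊎ (2 ≤ u × lb u ≡ false)) → lb x ≡ true → u + level x ≤ level u
  level-gap u x 1≤u u<x x≤n first barred = begin
    u + level x                                        ≡⟨ cong (u +_) (proj₁ (level-barred x (≤-trans (s≤s 1≤u) u<x) x≤n barred)) ⟩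
    u + suc (suc (barredAbove x))                      ≡⟨ +-suc u (suc (barredAbove x)) ⟩
    suc (u + suc (barredAbove x))                      ≤⟨ s≤s (+-monoʳ-≤ u (m≤n+m (suc (barredAbove x)) _)) ⟩
    suc (u + (count lb (range (suc u) (x ∸ suc u)) + suc (barredAbove x))) ≡⟨ cong (λ k → suc (u + k)) (sym split) ⟩
    suc (u + barredAbove u)                            ≡⟨ sym (level-upper u 1≤u (≤-trans (<⇒≤ u<x) x≤n) first) ⟩
    level u                                            ∎
    where
    open ≤-Reasoning
    split : barredAbove u ≡ count lb (range (suc u) (x ∸ suc u)) + suc (barredAbove x)
    split rewrite barredAbove-split u x u<x x≤n | barred = refl

module UpperRuns (m : ℕ) (a : List ℕ) (a↭ : a ↭ map suc (upTo (suc m))) where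

  open Levels m a a↭ public

  ub : ℕ → Bool
  ub = upperBarred a

  upperRun : ℕ → List ℕ
  upperRun u = decRun n (u ∸ 1)

  upperWord : ℕ → ℕ → List ℕ
  upperWord hi k = concatMap upperRun (filterᵇ ub (decRun hi k))

  unbarredAbove : ℕ → ℕ
  unbarredAbove v = count ub (decRun n (n ∸ v))

  -- Each run [n ⋯ n−u+2] lifts the current value by one; fits keeps it below n+1 before the last run,
  -- and reaches keeps it within the last (shortest) run.
  upperWord-shift : ∀ k hi V → k ≤ hi → hi ≤ n → V + count ub (decRun hi k) ≤ suc n →
    suc (suc n) ≤ V + count ub (decRun hi k) + (hi ∸ k) → Rises (upperWord hi k) V (V + count ub (decRun hi k))
  upperWord-shift zero hi V _ _ _ _ = subst (Rises [] V) (sym (+-identityʳ V)) (rises-[] V)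
  upperWord-shift (suc k) (suc h) V (s≤s k≤h) h≤n fits reaches with ub (suc h)
  ... | false = upperWord-shift k h V k≤h (≤-trans (n≤1+n h) h≤n) fits reaches
  ... | true = subst (Rises _ V) (sym (+-suc V c))
    (rises-++ (upperRun (suc h)) (upperWord h k) (decRun-inside n h V (≤-trans (n≤1+n h) h≤n) V≤n 1+n≤V+h)
      (upperWord-shift k h (suc V) k≤h (≤-trans (n≤1+n h) h≤n) (subst (_≤ suc n) (+-suc V c) fits)
        (subst (λ x → suc (suc n) ≤ x + (h ∸ k)) (+-suc V c) reaches)))
    where
    c = count ub (decRun h k)
    V≤n : V ≤ n
    V≤n = ≤-pred (<-≤-trans (m<m+n V (s≤s z≤n)) fits)
    1+n≤V+h : suc n ≤ V + h
    1+n≤V+h = ≤-pred (begin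
      suc (suc n)              ≤⟨ reaches ⟩
      V + suc c + (h ∸ k)      ≡⟨ trans (+-assoc V (suc c) (h ∸ k)) (+-suc V (c + (h ∸ k))) ⟩
      suc (V + (c + (h ∸ k)))  ≤⟨ s≤s (+-monoʳ-≤ V (+-monoˡ-≤ (h ∸ k) c≤k)) ⟩
      suc (V + (k + (h ∸ k)))  ≡⟨ cong (λ x → suc (V + x)) (m+[n∸m]≡n k≤h) ⟩
      suc (V + h)              ∎)
      where
      open ≤-Reasoning
      c≤k : c ≤ k
      c≤k = subst (c ≤_) (length-decRun h k) (count-≤ ub (decRun h k))

  barredAbove+unbarredAbove : ∀ v → v ≤ n → barredAbove v + unbarredAbove v ≡ n ∸ v
  barredAbove+unbarredAbove v v≤n = begin
    barredAbove v + count ub (decRun n (n ∸ v))                  ≡⟨ cong (λ w → barredAbove v + count ub w) run≡ ⟩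
    barredAbove v + count ub (reverse (range (suc v) (n ∸ v)))   ≡⟨ cong (barredAbove v +_) (count-reverse ub (range (suc v) (n ∸ v))) ⟩
    barredAbove v + count ub (range (suc v) (n ∸ v))             ≡⟨ count-complement lb (range (suc v) (n ∸ v)) ⟩
    length (range (suc v) (n ∸ v))                               ≡⟨ length-range (suc v) (n ∸ v) ⟩
    n ∸ v                                                        ∎
    where
    open ≡-Reasoning
    run≡ : decRun n (n ∸ v) ≡ reverse (range (suc v) (n ∸ v))
    run≡ = sym (trans (reverse-range (suc v) (n ∸ v)) (cong (λ hi → decRun hi (n ∸ v)) (m+[n∸m]≡n v≤n)))

  module UpperColumn (u : ℕ) (2≤u : 2 ≤ u) (u≤n : u ≤ n) (unbarred : lb u ≡ false) where

    1≤u : 1 ≤ u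
    1≤u = ≤-trans (s≤s z≤n) 2≤u

    pre : List ℕ
    pre = headWord ++ upperWord n (n ∸ u)

    level-u : level u ≡ suc (u + barredAbove u)
    level-u = level-upper u 1≤u u≤n (inj₂ (2≤u , unbarred))

    level-u+unbarred : level u + unbarredAbove u ≡ suc n
    level-u+unbarred = begin
      level u + unbarredAbove u                       ≡⟨ cong (_+ unbarredAbove u) level-u ⟩
      suc (u + barredAbove u + unbarredAbove u)       ≡⟨ cong suc (+-assoc u (barredAbove u) (unbarredAbove u)) ⟩
      suc (u + (barredAbove u + unbarredAbove u))     ≡⟨ cong (λ k → suc (u + k)) (barredAbove+unbarredAbove u u≤n) ⟩
      suc (u + (n ∸ u))                               ≡⟨ cong suc (m+[n∸m]≡n u≤n) ⟩
      suc n                                           ∎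
      where open ≡-Reasoning

    u<level : u < level u
    u<level = subst (u <_) (sym level-u) (s≤s (m≤m+n u (barredAbove u)))

    upperWord-above-u : ∀ V → V + unbarredAbove u ≤ suc n → suc (suc n) ≤ V + unbarredAbove u + u →
      Rises (upperWord n (n ∸ u)) V (V + unbarredAbove u)
    upperWord-above-u V fits reaches = upperWord-shift (n ∸ u) n V (m∸n≤m n u) ≤-refl fits
      (subst (λ k → suc (suc n) ≤ V + unbarredAbove u + k) (sym (m∸[m∸n]≡n u≤n)) reaches)

    module Orbit (t : ℕ) (2+t≤u : suc (suc t) ≤ u) (t+u≤n : t + u ≤ n) where

      x : ℕ
      x = iter (cox a) (suc t) u

      iterated : 1 ≤ x × x ≤ suc n × level x + suc t ≡ level u
      iterated = level-iter (suc t) u 1≤u u≤n (<-trans 2+t≤u u<level)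

      level-x : level x + suc t ≡ level u
      level-x = proj₂ (proj₂ iterated)

      x≤n : x ≤ n
      x≤n with m≤n⇒m<n∨m≡n (proj₁ (proj₂ iterated))
      ... | inj₁ x<1+n = ≤-pred x<1+n
      ... | inj₂ x≡top = ⊥-elim (<⇒≱ u<level (begin
        level u                  ≡⟨ sym level-x ⟩
        level x + suc t          ≡⟨ cong (λ y → level y + suc t) x≡top ⟩
        level (suc n) + suc t    ≡⟨ cong (_+ suc t) level-top ⟩
        suc (suc t)              ≤⟨ 2+t≤u ⟩
        u                        ∎))
        where open ≤-Reasoning

      level-x+unbarred+t : level x + unbarredAbove u + t ≡ n
      level-x+unbarred+t = suc-injective (begin
        suc (level x + q + t)    ≡⟨ rearrange (level x) q t ⟩
        level x + suc t + q      ≡⟨ cong (_+ q) level-x ⟩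
        level u + q              ≡⟨ level-u+unbarred ⟩
        suc n                    ∎)
        where
        open ≡-Reasoning
        q = unbarredAbove u
        rearrange : ∀ V q t → suc (V + q + t) ≡ V + suc t + q
        rearrange = solve-∀

      level-x+unbarred : level x + unbarredAbove u ≡ n ∸ t
      level-x+unbarred = sym (trans (cong (_∸ t) (sym level-x+unbarred+t)) (m+n∸n≡m (level x + unbarredAbove u) t))

      x<row : 2 ≤ x → lb x ≡ true → x < suc (n ∸ t)
      x<row _ barred with x <? suc (n ∸ t)
      ... | yes x<row = x<row
      ... | no x≮row = ⊥-elim (<⇒≱ 2+t≤u (+-cancelʳ-≤ (level x) u (suc t) (begin
        u + level x              ≤⟨ level-gap u x 1≤u u<x x≤n (inj₂ (2≤u , unbarred)) barred ⟩
        level u                  ≡⟨ sym level-x ⟩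
        level x + suc t          ≡⟨ +-comm (level x) (suc t) ⟩
        suc t + level x          ∎)))
        where
        open ≤-Reasoning
        u<x : u < x
        u<x = <-≤-trans (s≤s (m+n≤o⇒m≤o∸n u (subst (_≤ n) (+-comm t u) t+u≤n))) (≮⇒≥ x≮row)

      upper-shift : Rises (upperWord n (n ∸ u)) (level x) (n ∸ t)
      upper-shift = subst (Rises (upperWord n (n ∸ u)) (level x)) level-x+unbarred
        (upperWord-above-u (level x) (subst (_≤ suc n) (sym level-x+unbarred) (≤-trans (m∸n≤m n t) (n≤1+n n))) (begin
          suc (suc n)                                  ≡⟨ cong (λ k → suc (suc k)) (sym level-x+unbarred+t) ⟩
          suc (suc (level x + unbarredAbove u + t))    ≡⟨ sym (trans (+-suc _ (suc t)) (cong suc (+-suc _ t))) ⟩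
          level x + unbarredAbove u + suc (suc t)      ≤⟨ +-monoʳ-≤ (level x + unbarredAbove u) 2+t≤u ⟩
          level x + unbarredAbove u + u                ∎))
        where open ≤-Reasoning

      pre-end : wordPerm⁻¹ pre x ≡ n ∸ t
      pre-end = ends-++ headWord (upperWord n (n ∸ u)) refl (proj₁ upper-shift)

      pre-avoids : Avoids pre x (suc (n ∸ t))
      pre-avoids = avoids-++ headWord (upperWord n (n ∸ u)) x (suc (n ∸ t))
        (headWord-avoids x (suc (n ∸ t)) (proj₁ iterated) x≤n (s≤s (subst (level x ≤_) level-x+unbarred (m≤m+n _ _))) x<row)
        (rises⇒avoids-above (upperWord n (n ∸ u)) upper-shift ≤-refl)

    orbitColumns : ∀ k → k ≤ u ∸ 1 → k ≤ n + 1 ∸ u →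
      FirstHits pre (decRun n k) (map (λ t → (n + 1 ∸ t , iter (cox a) (suc t) u)) (upTo k))
    orbitColumns k k≤u-1 k≤n+1-u e row col eq with nth-map⁻ (λ t → (n + 1 ∸ t , iter (cox a) (suc t) u)) (upTo k) e eq
    ... | t , nth≡t , refl with nth-applyUpTo⁻ (λ i → i) k e nth≡t
    ... | e<k , refl rewrite take-decRun n k e (<⇒≤ e<k) | take-decRun n k (suc e) e<k =
      subst (λ r → Avoids (pre ++ decRun n e) x r × wordPerm⁻¹ (pre ++ decRun n (suc e)) x ≡ r) (sym row≡)
        (avoids-++ pre (decRun n e) x (suc (n ∸ e)) pre-avoids
          (subst (λ y → Avoids (decRun n e) y (suc (n ∸ e))) (sym pre-end) (rises⇒avoids-above (decRun n e) stay ≤-refl)) ,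
         ends-++ pre (decRun n (suc e)) pre-end (proj₁ step))
      where
      2+e≤u : suc (suc e) ≤ u
      2+e≤u = subst (suc (suc e) ≤_) (m+[n∸m]≡n 1≤u) (s≤s (≤-trans e<k k≤u-1))
      e+u≤n : e + u ≤ n
      e+u≤n = ≤-pred (subst (suc e + u ≤_) (+-comm n 1) (m≤o∸n⇒m+n≤o (suc e) (≤-trans u≤n (m≤m+n n 1)) (≤-trans e<k k≤n+1-u)))
      e≤n : e ≤ n
      e≤n = m+n≤o⇒m≤o e e+u≤n
      row≡ : n + 1 ∸ e ≡ suc (n ∸ e)
      row≡ = trans (cong (_∸ e) (+-comm n 1)) (+-∸-assoc 1 e≤n)
      open Orbit e 2+e≤u e+u≤n using (x; pre-end; pre-avoids)
      stay : Rises (decRun n e) (n ∸ e) (n ∸ e)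
      stay = decRun-outside n e (n ∸ e) e≤n (inj₁ (≤-reflexive (m∸n+n≡m e≤n)))
      step : Rises (decRun n (suc e)) (n ∸ e) (suc (n ∸ e))
      step = decRun-inside n (suc e) (n ∸ e) (≤-trans (subst (_≤ e + u) (+-comm e 1) (+-monoʳ-≤ e 1≤u)) e+u≤n) (m∸n≤m n e)
        (≤-reflexive (sym (trans (+-suc (n ∸ e) e) (cong suc (m∸n+n≡m e≤n)))))

    pre-lifts-u : Rises pre u (suc n)
    pre-lifts-u = rises-++ headWord (upperWord n (n ∸ u))
      (subst (Rises headWord u) (sym level-u) (level-unbarred u 1≤u u≤n (λ _ → unbarred)))
      (subst (Rises (upperWord n (n ∸ u)) (level u)) level-u+unbarred
        (upperWord-above-u (level u) (≤-reflexive level-u+unbarred)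
          (subst (λ k → suc (suc n) ≤ k + u) (sym level-u+unbarred) (subst (_≤ suc n + u) (+-comm (suc n) 1) (+-monoʳ-≤ (suc n) 1≤u)))))

    selfColumn : ∀ k → k ≡ n + 1 ∸ u →
      FirstHits (pre ++ decRun n k) (decRun (n ∸ k) (u ∸ 1 ∸ k)) (map (λ i → (i , u)) (decRun (u ∸ 1) (u ∸ 1 ∸ k)))
    selfColumn k k≡ =
      subst (λ hi → FirstHits (pre ++ decRun n k) (decRun hi (u ∸ 1 ∸ k)) (map (λ i → (i , u)) (decRun (u ∸ 1) (u ∸ 1 ∸ k))))
        (sym n∸k≡u-1)
      (firstHits-column (pre ++ decRun n k) (u ∸ 1) (u ∸ 1 ∸ k) u (sym (m+[n∸m]≡n 1≤u)) (m∸n≤m (u ∸ 1) k) returns avoids)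
      where
      k≡′ : k ≡ suc n ∸ u
      k≡′ = trans k≡ (cong (_∸ u) (+-comm n 1))
      k≤n : k ≤ n
      k≤n = subst (_≤ n) (sym k≡′) (∸-monoʳ-≤ (suc n) 1≤u)
      1+n∸k≡u : suc n ∸ k ≡ u
      1+n∸k≡u = trans (cong (suc n ∸_) k≡′) (m∸[m∸n]≡n (m≤n⇒m≤1+n u≤n))
      n∸k≡u-1 : n ∸ k ≡ u ∸ 1
      n∸k≡u-1 = cong pred (trans (sym (+-∸-assoc 1 k≤n)) 1+n∸k≡u)
      falls : Falls (decRun n k) (suc n) u
      falls = let end , ds = decRun-top n k k≤n in trans end 1+n∸k≡u , ds
      returns : wordPerm⁻¹ (pre ++ decRun n k) u ≡ u
      returns = ends-++ pre (decRun n k) (proj₁ pre-lifts-u) (proj₁ falls)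
      avoids : ∀ r → r < u → Avoids (pre ++ decRun n k) u r
      avoids r r<u = avoids-++ pre (decRun n k) u r (rises⇒avoids-below pre pre-lifts-u r<u)
        (subst (λ y → Avoids (decRun n k) y r) (sym (proj₁ pre-lifts-u)) (falls⇒avoids-below (decRun n k) falls r<u))

    m′ : ℕ
    m′ = (u ∸ 1) ⊓ (n + 1 ∸ u)

    2u≡ : 2 * u ≡ suc ((u ∸ 1) + u)
    2u≡ = trans (cong (u +_) (+-identityʳ u)) (cong (_+ u) (sym (m+[n∸m]≡n 1≤u)))

    m′-large : (n + 2 <ᵇ 2 * u) ≡ true → m′ ≡ n + 1 ∸ u
    m′-large large = m≥n⇒m⊓n≡n (m≤n+o⇒m∸n≤o (n + 1) u (subst (n + 1 ≤_) (+-comm (u ∸ 1) u) n+1≤))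
      where
      n+1≤ : n + 1 ≤ (u ∸ 1) + u
      n+1≤ = ≤-trans (+-monoʳ-≤ n (n≤1+n 1)) (≤-pred (subst (suc (n + 2) ≤_) 2u≡ (<ᵇ≡true⇒< (n + 2) (2 * u) large)))

    m′-small : (n + 2 <ᵇ 2 * u) ≡ false → m′ ≡ u ∸ 1
    m′-small small = m≤n⇒m⊓n≡m (m+n≤o⇒m≤o∸n (u ∸ 1) (≤-pred (begin
      suc ((u ∸ 1) + u)      ≡⟨ sym 2u≡ ⟩
      2 * u                  ≤⟨ <ᵇ≡false⇒≥ (n + 2) (2 * u) small ⟩
      n + 2                  ≡⟨ +-suc n 1 ⟩
      suc (n + 1)            ∎)))
      where open ≤-Reasoning

    orbitPositions : List (ℕ × ℕ)
    orbitPositions = map (λ t → (n + 1 ∸ t , iter (cox a) (suc t) u)) (upTo m′)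

    selfPositions : List (ℕ × ℕ)
    selfPositions = if (n + 2) <ᵇ (2 * u) then map (λ i → (i , u)) (decRun (u ∸ 1) (u ∸ 1 ∸ m′)) else []

    m′≤u-1 : m′ ≤ u ∸ 1
    m′≤u-1 = m⊓n≤m (u ∸ 1) (n + 1 ∸ u)

    upperRun-split : upperRun u ≡ decRun n m′ ++ decRun (n ∸ m′) (u ∸ 1 ∸ m′)
    upperRun-split = trans (cong (decRun n) (sym (m+[n∸m]≡n m′≤u-1))) (decRun-++ n m′ (u ∸ 1 ∸ m′))

    length-orbitPositions : length (decRun n m′) ≡ length orbitPositions
    length-orbitPositions = trans (length-decRun n m′)
      (sym (trans (length-map (λ t → (n + 1 ∸ t , iter (cox a) (suc t) u)) (upTo m′)) (length-upTo m′)))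

    selfPositions-firstHits : FirstHits (pre ++ decRun n m′) (decRun (n ∸ m′) (u ∸ 1 ∸ m′)) selfPositions
    selfPositions-firstHits with (n + 2) <ᵇ (2 * u) in large
    ... | true = selfColumn m′ (m′-large large)
    ... | false = firstHits-[] _ _

    upperRun-firstHits : FirstHits pre (upperRun u) (uPositions n a u)
    upperRun-firstHits = subst (λ w → FirstHits pre w (uPositions n a u)) (sym upperRun-split)
      (firstHits-++ pre (decRun n m′) orbitPositions (decRun (n ∸ m′) (u ∸ 1 ∸ m′)) selfPositions length-orbitPositions
        (orbitColumns m′ m′≤u-1 (m⊓n≤n (u ∸ 1) (n + 1 ∸ u))) selfPositions-firstHits)

    length-selfPositions : length selfPositions ≡ u ∸ 1 ∸ m′
    length-selfPositions with (n + 2) <ᵇ (2 * u) in large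
    ... | true = trans (length-map (λ i → (i , u)) (decRun (u ∸ 1) (u ∸ 1 ∸ m′))) (length-decRun (u ∸ 1) (u ∸ 1 ∸ m′))
    ... | false = sym (trans (cong (u ∸ 1 ∸_) (m′-small large)) (n∸n≡0 (u ∸ 1)))

    length-upperRun : length (upperRun u) ≡ length (uPositions n a u)
    length-upperRun = begin
      length (upperRun u)                              ≡⟨ length-decRun n (u ∸ 1) ⟩
      u ∸ 1                                            ≡⟨ sym (m+[n∸m]≡n m′≤u-1) ⟩
      m′ + (u ∸ 1 ∸ m′)                                ≡⟨ cong₂ _+_ (trans (sym (length-decRun n m′)) length-orbitPositions) (sym length-selfPositions) ⟩
      length orbitPositions + length selfPositions     ≡⟨ sym (length-++ orbitPositions) ⟩
      length (uPositions n a u)                        ∎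
      where open ≡-Reasoning

module Positions (m : ℕ) (a : List ℕ) (a↭ : a ↭ map suc (upTo (suc m))) where

  open UpperRuns m a a↭ public

  upperPositions : ℕ → ℕ → List (ℕ × ℕ)
  upperPositions hi k = concatMap (uPositions n a) (filterᵇ ub (decRun hi k))

  upper⇒¬lower : ∀ x → ub x ≡ true → lb x ≡ false
  upper⇒¬lower x upper with lb x
  ... | false = refl
  upper⇒¬lower x () | true

  upperWord-∷ʳ : ∀ h → h < n → upperWord n (n ∸ h) ≡ upperWord n (n ∸ suc h) ++ concatMap upperRun (filterᵇ ub [ suc h ])
  upperWord-∷ʳ h h<n = begin
    concatMap upperRun (filterᵇ ub (decRun n (n ∸ h)))                      ≡⟨ cong (λ w → concatMap upperRun (filterᵇ ub w)) run≡ ⟩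
    concatMap upperRun (filterᵇ ub (decRun n j ++ [ suc h ]))               ≡⟨ cong (concatMap upperRun) (filter-++ (λ y → T? (ub y)) (decRun n j) [ suc h ]) ⟩
    concatMap upperRun (filterᵇ ub (decRun n j) ++ filterᵇ ub [ suc h ])    ≡⟨ concatMap-++ upperRun (filterᵇ ub (decRun n j)) _ ⟩
    upperWord n j ++ concatMap upperRun (filterᵇ ub [ suc h ])               ∎
    where
    open ≡-Reasoning
    j = n ∸ suc h
    run≡ : decRun n (n ∸ h) ≡ decRun n j ++ [ suc h ]
    run≡ = begin
      decRun n (n ∸ h)               ≡⟨ cong (decRun n) (trans (+-∸-assoc 1 h<n) (+-comm 1 j)) ⟩
      decRun n (j + 1)               ≡⟨ decRun-++ n j 1 ⟩
      decRun n j ++ [ n ∸ j ]        ≡⟨ cong (λ x → decRun n j ++ [ x ]) (m∸[m∸n]≡n h<n) ⟩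
      decRun n j ++ [ suc h ]        ∎

  upperWord-firstHits : ∀ k hi → hi ≤ n → k < hi →
    FirstHits (headWord ++ upperWord n (n ∸ hi)) (upperWord hi k) (upperPositions hi k)
  upperWord-firstHits zero hi _ _ = firstHits-[] _ _
  upperWord-firstHits (suc k) (suc h) h<n (s≤s k<h) with ub (suc h) in upper | upperWord-∷ʳ h h<n
  ... | false | snoc = subst (λ w → FirstHits (headWord ++ w) (upperWord h k) (upperPositions h k)) (trans snoc (++-identityʳ _))
    (upperWord-firstHits k h (≤-trans (n≤1+n h) h<n) k<h)
  ... | true | snoc = firstHits-++ (headWord ++ upperWord n (n ∸ suc h)) (upperRun (suc h)) (uPositions n a (suc h))
    (upperWord h k) (upperPositions h k) length-upperRun upperRun-firstHits
    (subst (λ w → FirstHits w (upperWord h k) (upperPositions h k))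
      (trans (cong (headWord ++_) (trans snoc (cong (upperWord n (n ∸ suc h) ++_) (++-identityʳ _)))) (sym (++-assoc headWord _ _)))
      (upperWord-firstHits k h (≤-trans (n≤1+n h) h<n) k<h))
    where open UpperColumn (suc h) (s≤s (≤-trans (s≤s z≤n) k<h)) h<n (upper⇒¬lower (suc h) upper)

  length-upperWord : ∀ k hi → hi ≤ n → k < hi → length (upperWord hi k) ≡ length (upperPositions hi k)
  length-upperWord zero hi _ _ = refl
  length-upperWord (suc k) (suc h) h<n (s≤s k<h) with ub (suc h) in upper
  ... | false = length-upperWord k h (≤-trans (n≤1+n h) h<n) k<h
  ... | true = begin
    length (upperRun (suc h) ++ upperWord h k)                     ≡⟨ length-++ (upperRun (suc h)) ⟩
    length (upperRun (suc h)) + length (upperWord h k)             ≡⟨ cong₂ _+_ length-upperRun (length-upperWord k h (≤-trans (n≤1+n h) h<n) k<h) ⟩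
    length (uPositions n a (suc h)) + length (upperPositions h k)  ≡⟨ sym (length-++ (uPositions n a (suc h))) ⟩
    length (uPositions n a (suc h) ++ upperPositions h k)          ∎
    where
    open ≡-Reasoning
    open UpperColumn (suc h) (s≤s (≤-trans (s≤s z≤n) k<h)) h<n (upper⇒¬lower (suc h) upper)

  dList≡ : dList n a ≡ filterᵇ lb (range 2 m)
  dList≡ = cong (filterᵇ lb) (twoToN≡range m)

  reverse-uList≡ : reverse (uList n a) ≡ filterᵇ ub (decRun n m)
  reverse-uList≡ = begin
    reverse (filterᵇ ub (twoToN n))      ≡⟨ cong (λ xs → reverse (filterᵇ ub xs)) (twoToN≡range m) ⟩
    reverse (filterᵇ ub (range 2 m))     ≡⟨ sym (filterᵇ-reverse ub (range 2 m)) ⟩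
    filterᵇ ub (reverse (range 2 m))     ≡⟨ cong (filterᵇ ub) (reverse-range 2 m) ⟩
    filterᵇ ub (decRun n m)              ∎
    where open ≡-Reasoning

  Rword≡ : Rword n a ≡ headWord ++ upperWord n m
  Rword≡ = trans (cong₂ (λ ds us → concatMap lowerRun ds ++ (decRun n n ++ concatMap upperRun us)) dList≡ reverse-uList≡)
                 (sym (++-assoc dWord (decRun n n) _))

  positionsRaw≡ : positionsRaw n a ≡ headColumns ++ upperPositions n m
  positionsRaw≡ = trans (cong₂ (λ ds us → concatMap lowerColumn ds ++ (map (λ i → (i , n + 1)) (decRun n n) ++ concatMap (uPositions n a) us))
                               dList≡ reverse-uList≡)
                        (sym (++-assoc (lowerColumns 2 m) _ _))

  length-headColumns : length headWord ≡ length headColumns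
  length-headColumns = begin
    length (dWord ++ decRun n n)                                  ≡⟨ length-++ dWord ⟩
    length dWord + length (decRun n n)                            ≡⟨ cong₂ _+_ (length-lowerColumns (filterᵇ lb (range 2 m))) (sym (length-map (λ i → (i , n + 1)) (decRun n n))) ⟩
    length (lowerColumns 2 m) + length (map (λ i → (i , n + 1)) (decRun n n)) ≡⟨ sym (length-++ (lowerColumns 2 m)) ⟩
    length headColumns                                            ∎
    where open ≡-Reasoning

  upperWord-firstHits-all : FirstHits headWord (upperWord n m) (upperPositions n m)
  upperWord-firstHits-all = subst (λ w → FirstHits w (upperWord n m) (upperPositions n m))
    (trans (cong (λ k → headWord ++ upperWord n k) (n∸n≡0 n)) (++-identityʳ headWord))
    (upperWord-firstHits m n ≤-refl ≤-refl)

  Rword-firstHits : FirstHits [] (Rword n a) (positionsRaw n a)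
  Rword-firstHits = subst₂ (FirstHits []) (sym Rword≡) (sym positionsRaw≡)
    (firstHits-++ [] headWord headColumns (upperWord n m) (upperPositions n m) length-headColumns headWord-firstHits upperWord-firstHits-all)

  length-Rword : length (Rword n a) ≡ Nn n
  length-Rword = begin
    length (Rword n a)                                   ≡⟨ cong length Rword≡ ⟩
    length ((dWord ++ decRun n n) ++ upperWord n m)      ≡⟨ trans (length-++ (dWord ++ decRun n n)) (cong (_+ length (upperWord n m)) (length-++ dWord)) ⟩
    length dWord + length (decRun n n) + length (upperWord n m)
      ≡⟨ cong₂ (λ x y → x + length (decRun n n) + y) (length-concatMap-runs lowerRun (λ d → length-decRun (d ∸ 1) (d ∸ 1)) (filterᵇ lb R))
                                                        (length-concatMap-runs upperRun (λ u → length-decRun n (u ∸ 1)) (filterᵇ ub (decRun n m))) ⟩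
    Sl + length (decRun n n) + sum (map (_∸ 1) (filterᵇ ub (decRun n m)))
      ≡⟨ cong₂ (λ x y → Sl + x + y) (length-decRun n n) upper-sum ⟩
    Sl + n + Su                                          ≡⟨ rearrange Sl n Su ⟩
    n + (Sl + Su)                                        ≡⟨ cong (n +_) (trans (sum-filter-complement (_∸ 1) lb R) (sum-range-∸1 m)) ⟩
    n + n C 2                                            ≡⟨ cong (_+ n C 2) (sym (nC1≡n n)) ⟩
    n C 1 + n C 2                                        ≡⟨ nCk+nC[k+1]≡[n+1]C[k+1] n 1 ⟩
    Nn n                                                 ∎
    where
    open ≡-Reasoning
    R = range 2 m
    Sl = sum (map (_∸ 1) (filterᵇ lb R))
    Su = sum (map (_∸ 1) (filterᵇ ub R))
    upper-sum : sum (map (_∸ 1) (filterᵇ ub (decRun n m))) ≡ Su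
    upper-sum = sum-↭ (↭.map⁺ (_∸ 1) (subst (λ xs → filterᵇ ub xs ↭ filterᵇ ub R) (reverse-range 2 m)
      (↭.filter-↭ (λ y → T? (ub y)) (↭.↭-reverse R))))
    rearrange : ∀ x y z → x + y + z ≡ y + (x + z)
    rearrange = solve-∀

  length-positionsRaw : length (positionsRaw n a) ≡ Nn n
  length-positionsRaw = begin
    length (positionsRaw n a)                              ≡⟨ cong length positionsRaw≡ ⟩
    length (headColumns ++ upperPositions n m)             ≡⟨ length-++ headColumns ⟩
    length headColumns + length (upperPositions n m)       ≡⟨ cong₂ _+_ (sym length-headColumns) (sym (length-upperWord m n ≤-refl ≤-refl)) ⟩
    length headWord + length (upperWord n m)               ≡⟨ sym (length-++ headWord) ⟩
    length (headWord ++ upperWord n m)                     ≡⟨ cong length (sym Rword≡) ⟩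
    length (Rword n a)                                     ≡⟨ length-Rword ⟩
    Nn n                                                   ∎
    where open ≡-Reasoning

module Solution (m : ℕ) (a : List ℕ) (a↭ : a ↭ map suc (upTo (suc m))) where

  open Positions m a a↭ using (n; Rword-firstHits; length-positionsRaw)

  N : ℕ
  N = Nn n

  R : List ℕ
  R = Rword n a

  Proj-at : ∀ X (k : Fin N) {row col} → nth (positions n a) (toℕ k) ≡ just (row , col) → Proj n a X k ≡ X row col
  Proj-at X k eq with nth (positions n a) (toℕ k)
  Proj-at X k refl | .(just _) = refl

  nth-positions : ∀ (k : Fin N) → nth (positions n a) (toℕ k) ≡ nth (positionsRaw n a) (N ∸ suc (toℕ k))
  nth-positions k = trans (nth-reverse (positionsRaw n a) (toℕ k) (subst (toℕ k <_) (sym length-positionsRaw) (toℕ<n k)))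
                          (cong (λ l → nth (positionsRaw n a) (l ∸ suc (toℕ k))) length-positionsRaw)

  firstHit : ∀ (k : Fin N) → ∃₂ λ row col → nth (positions n a) (toℕ k) ≡ just (row , col) ×
    Avoids (take (N ∸ suc (toℕ k)) R) col row × wordPerm⁻¹ (take (suc (N ∸ suc (toℕ k))) R) col ≡ row
  firstHit k with <⇒nth (positionsRaw n a) (N ∸ suc (toℕ k))
                    (subst (N ∸ suc (toℕ k) <_) (sym length-positionsRaw) (∸-monoʳ-< (s≤s z≤n) (toℕ<n k)))
  ... | (row , col) , raw≡ = row , col , trans (nth-positions k) raw≡ , Rword-firstHits (N ∸ suc (toℕ k)) row col raw≡

  column : Fin N → Fin N → ℚ
  column t = Proj n a (Xmat (bElt n a (suc (toℕ t))))

  -- The columns of Q are Π_c(X(b_N)), …, Π_c(X(b_1)); by firstHit, Q is lower unitriangular.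
  Q : Matrix N
  Q j s = column (opposite s) j

  b-index : ∀ (s : Fin N) → suc (toℕ (opposite s)) ≡ suc (N ∸ suc (toℕ s))
  b-index s = cong suc (opposite-prop s)

  Q-diagonal : ∀ s → Q s s ≡ 1ℚ
  Q-diagonal s with firstHit s
  ... | row , col , at , _ , hit = trans (Proj-at _ s at) one
    where
    b-hits : wordPerm (take (suc (toℕ (opposite s))) R) row ≡ col
    b-hits = subst (λ i → wordPerm (take i R) row ≡ col) (sym (b-index s))
      (Equivalence.from (wordPerm-inverse (take (suc (N ∸ suc (toℕ s))) R) col row) hit)
    one : Xmat (bElt n a (suc (toℕ (opposite s)))) row col ≡ 1ℚ
    one rewrite b-hits | ≡ᵇ-refl col = refl

  Q-upper : ∀ j s → toℕ j < toℕ s → Q j s ≡ 0ℚ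
  Q-upper j s j<s with firstHit j
  ... | row , col , at , avoids , _ = trans (Proj-at _ j at) zero′
    where
    i = suc (toℕ (opposite s))
    i≤ : i ≤ N ∸ suc (toℕ j)
    i≤ = subst (_≤ N ∸ suc (toℕ j)) (sym (trans (b-index s) (sym (+-∸-assoc 1 (toℕ<n s))))) (∸-monoʳ-≤ N j<s)
    misses : wordPerm⁻¹ (take i R) col ≢ row
    misses = subst (λ w → wordPerm⁻¹ w col ≢ row)
      (trans (take-take i (N ∸ suc (toℕ j)) R) (cong (λ l → take l R) (m≤n⇒m⊓n≡m i≤)))
      (avoids-take (take (N ∸ suc (toℕ j)) R) col row i avoids)
    zero′ : Xmat (bElt n a i) row col ≡ 0ℚ
    zero′ rewrite ≢⇒≡ᵇ≡false (wordPerm (take i R) row) col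
                    (λ hit → misses (Equivalence.to (wordPerm-inverse (take i R) col row) hit)) = refl

  Q-lowerUnitri : LowerUnitri Q
  Q-lowerUnitri = Q-diagonal , Q-upper

  targets : Fin N → Fin N → ℚ
  targets k s = oVec N (suc (toℕ (opposite s))) k

  targets≡ : ∀ k s → targets k s ≡ (if toℕ s <ᵇ suc (toℕ k) then 1ℚ else 0ℚ)
  targets≡ k s = cong (λ l → if l <ᵇ suc (toℕ k) then 1ℚ else 0ℚ) (begin
    N ∸ suc (toℕ (opposite s))      ≡⟨ cong (N ∸_) (b-index s) ⟩
    N ∸ suc (N ∸ suc (toℕ s))       ≡⟨ cong (N ∸_) (sym (+-∸-assoc 1 (toℕ<n s))) ⟩
    N ∸ (N ∸ toℕ s)                 ≡⟨ m∸[m∸n]≡n (<⇒≤ (toℕ<n s)) ⟩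
    toℕ s                           ∎)
    where open ≡-Reasoning

  U : Matrix N
  U k = proj₁ (vecMat-solvable Q Q-lowerUnitri (targets k))

  U-row-solves : ∀ k s → vecMat (U k) Q s ≡ targets k s
  U-row-solves k = proj₂ (vecMat-solvable Q Q-lowerUnitri (targets k))

  targets-beyond : ∀ k s → toℕ k < toℕ s → targets k s ≡ 0ℚ
  targets-beyond k s k<s with toℕ s <ᵇ suc (toℕ k) in lt | targets≡ k s
  ... | false | t≡ = t≡
  ... | true | _ = ⊥-elim (<⇒≱ k<s (≤-pred (<ᵇ≡true⇒< (toℕ s) (suc (toℕ k)) lt)))

  targets-diagonal : ∀ k → targets k k ≡ 1ℚ
  targets-diagonal k rewrite targets≡ k k | n<ᵇ1+n (toℕ k) = refl

  U-support : ∀ k → (∀ j → toℕ k < toℕ j → U k j ≡ 0ℚ) × (∀ j → toℕ j ≡ toℕ k → U k j ≡ targets k j)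
  U-support k = vecMat-support Q Q-lowerUnitri (U k) (targets k) (U-row-solves k) (toℕ k) (targets-beyond k)

  U-lowerUnitri : LowerUnitri U
  U-lowerUnitri = (λ k → trans (proj₂ (U-support k) k refl) (targets-diagonal k)) , (λ k j → proj₁ (U-support k) j)

  U-solves : Solves n a U
  U-solves t k = subst (λ t′ → sumF (λ j → U k j *ℚ column t′ j) ≡ oVec N (suc (toℕ t′)) k)
    (opposite-involutive t) (U-row-solves k (opposite t))

  U-unique : (V : Matrix N) → LowerUnitri V → Solves n a V → ∀ i j → V i j ≡ U i j
  U-unique V _ V-solves i = vecMat-injective Q Q-lowerUnitri (V i) (U i)
    (λ s → trans (V-solves (opposite s) i) (sym (U-row-solves i s)))

proposition6p13 : (n : ℕ) (a : List ℕ) → a ↭ map suc (upTo n) →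
    Σ (Matrix (Nn n)) (λ U → LowerUnitri U × Solves n a U
    × ((V : Matrix (Nn n)) → LowerUnitri V → Solves n a V → ∀ i j → V i j ≡ U i j))
proposition6p13 zero a _ = (λ ()) , ((λ ()) , (λ ())) , (λ ()) , (λ _ _ _ ())
proposition6p13 (suc m) a a↭ = U , U-lowerUnitri , U-solves , U-unique
  where open Solution m a a↭
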